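{- For any integers $p,q\ge 0$ and $m,n\ge 1$, the poset $\mathbf{p}\oplus(\mathbf{m}\times\mathbf{n})\oplus\mathbf{q}$ is a nice distributive lattice.
   Context: $\mathbf{m}$ denotes the $m$-element chain ($\mathbf{0}$ is empty) and $\mathbf{m}\times\mathbf{n}$ the product poset. For posets $P,Q$, $P\oplus Q$ (called the direct sum in the paper) is the poset on the disjoint union of $P$ and $Q$ keeping the orders of $P$ and $Q$ and declaring every element of $P$ below every element of $Q$. A chain partition of a finite poset is a partition of it into chains; its type is the partition formed by the block sizes in weakly decreasing order. For partitions of the same integer, $\mu\unlhd\nu$ means $\sum_{i\le k}\mu_i\le\sum_{i\le k}\nu_i$ for all $k$. A poset $P$ is nice if whenever $P$ has a chain partition of type $\lambda$, it also has one of type $\mu$ for every $\mu\unlhd\lambda$. -}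

module Defs where

open import Level using (0ℓ)
open import Data.Nat using (ℕ; zero; suc; _+_; _≤_; _≥_)
open import Data.Fin using (Fin)
import Data.Fin as F
open import Data.Sum using (_⊎_; inj₁; inj₂)
open import Data.Product using (_×_; _,_; Σ; ∃; ∃-syntax)
open import Data.Empty using (⊥)
open import Data.Unit using (⊤)
open import Data.List using (List; []; _∷_; map; length; concat; take)
open import Data.Nat.ListAction using (sum)
open import Data.List.Membership.Propositional using (_∈_)
open import Data.List.Relation.Unary.All using (All)
open import Data.List.Relation.Unary.Linked using (Linked)
open import Data.List.Relation.Unary.AllPairs using (AllPairs)
open import Data.List.Relation.Unary.Unique.Propositional using (Unique)
open import Relation.Binary.Core using (Rel)
open import Relation.Binary.PropositionalEquality using (_≡_)
open import Relation.Binary.Lattice.Structures using (IsDistributiveLattice)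

ChainOrd : (m : ℕ) → Rel (Fin m) 0ℓ
ChainOrd m = F._≤_

ProdOrd : {A B : Set} → Rel A 0ℓ → Rel B 0ℓ → Rel (A × B) 0ℓ
ProdOrd _≤A_ _≤B_ (a , b) (a' , b') = (a ≤A a') × (b ≤B b')

SumOrd : {A B : Set} → Rel A 0ℓ → Rel B 0ℓ → Rel (A ⊎ B) 0ℓ
SumOrd _≤A_ _≤B_ (inj₁ a) (inj₁ a') = a ≤A a'
SumOrd _≤A_ _≤B_ (inj₁ a) (inj₂ b)  = ⊤
SumOrd _≤A_ _≤B_ (inj₂ b) (inj₁ a)  = ⊥
SumOrd _≤A_ _≤B_ (inj₂ b) (inj₂ b') = b ≤B b'

Carrier : ℕ → ℕ → ℕ → ℕ → Set
Carrier p m n q = Fin p ⊎ ((Fin m × Fin n) ⊎ Fin q)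

Ord : (p m n q : ℕ) → Rel (Carrier p m n q) 0ℓ
Ord p m n q = SumOrd (ChainOrd p) (SumOrd (ProdOrd (ChainOrd m) (ChainOrd n)) (ChainOrd q))

IsDistributiveLatticePoset : {A : Set} → Rel A 0ℓ → Set
IsDistributiveLatticePoset {A} _≤_ =
  Σ (A → A → A) λ _∨_ → Σ (A → A → A) λ _∧_ →
    IsDistributiveLattice _≡_ _≤_ _∨_ _∧_

IsChain : {A : Set} → Rel A 0ℓ → List A → Set
IsChain _≤_ xs = AllPairs (λ x y → (x ≤ y) ⊎ (y ≤ x)) xs

IsChainPartition : {A : Set} → Rel A 0ℓ → List (List A) → Set
IsChainPartition {A} _≼_ blocks =
  All (IsChain _≼_) blocks
  × All (λ b → 1 ≤ length b) blocks
  × Unique (concat blocks)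
  × (∀ (x : A) → x ∈ concat blocks)

IsPartition : List ℕ → Set
IsPartition λs = Linked _≥_ λs × All (λ k → 1 ≤ k) λs

HasChainPartitionOfType : {A : Set} → Rel A 0ℓ → List ℕ → Set
HasChainPartitionOfType _≤_ λs =
  ∃[ blocks ] (IsChainPartition _≤_ blocks × map length blocks ≡ λs)

_⊴_ : List ℕ → List ℕ → Set
μ ⊴ ν = ∀ (k : ℕ) → sum (take k μ) ≤ sum (take k ν)

Nice : {A : Set} → Rel A 0ℓ → Set
Nice _≤_ = ∀ (λs μ : List ℕ) → IsPartition λs → IsPartition μ →
  sum μ ≡ sum λs → μ ⊴ λs →
  HasChainPartitionOfType _≤_ λs → HasChainPartitionOfType _≤_ μ

-- Chains, products and ordinal sums of distributive lattices are distributive lattices.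
--
-- For niceness, grade P = 𝐩 ⊕ (𝐦 × 𝐧) ⊕ 𝐪 by levels: the elements of 𝐩, then the
-- antidiagonals i + j = t of the grid, then the elements of 𝐪; let w ℓ be the size of level ℓ.
-- A chain meets every level at most once, so a chain partition of type λ satisfies
-- λ₁ + … + λₖ ≤ Σ_ℓ min(k, w ℓ) for all k, and hence so does every μ ⊴ λ.  Conversely, the
-- level sizes form a mountain (steps of at most one, up to a peak and then down), and for
-- every mountain f ≤ w the elements of rank f ℓ ∸ 1 on the levels with f ℓ > 0 form a
-- chain.  A partition μ obeying the bound is therefore realised greedily: the first chain
-- takes the top available element of the μ₁ levels with most available elements, ties being
-- broken so that the remaining profile is again a mountain, and the bound for the remaining
-- parts of μ and the remaining profile follows as in the Gale–Ryser theorem.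

module Submission where

open import Level using (0ℓ)
open import Function using (_∘_)
open import Algebra.Core using (Op₂)
import Algebra.Construct.NaturalChoice.Min as Min
import Algebra.Construct.NaturalChoice.Max as Max
import Algebra.Construct.NaturalChoice.MinMaxOp as MinMaxOp
open import Data.Nat
open import Data.Nat.Properties
open import Data.Nat.ListAction using (sum)
open import Data.Fin using (Fin; toℕ; fromℕ<)
import Data.Fin.Properties as Fin
open import Data.Product using (_×_; _,_; proj₁; proj₂; ∃-syntax; Σ-syntax)
open import Data.Sum using (_⊎_; inj₁; inj₂)
open import Data.Unit using (tt)
open import Data.List using (List; []; _∷_; _++_; take; drop; map; length; concat; filter; upTo)
open import Data.List.Properties
  using (filter-notAll; filter-++; length-upTo; length-++; length-map; length-take; take-map; concat-++; take++drop≡id)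
open import Data.List.Relation.Unary.All as All using (All; []; _∷_)
import Data.List.Relation.Unary.All.Properties as All
open import Data.List.Relation.Unary.Any as Any using (here; there)
open import Data.List.Relation.Unary.AllPairs using (AllPairs; []; _∷_)
import Data.List.Relation.Unary.AllPairs.Properties as AllPairs
open import Data.List.Relation.Unary.Linked as Linked using (Linked; [-]; _∷_)
open import Data.List.Relation.Unary.Unique.Propositional using (Unique)
import Data.List.Relation.Unary.Unique.Propositional.Properties as Unique
open import Data.List.Relation.Binary.Disjoint.Propositional using (Disjoint)
open import Data.List.Membership.Propositional using (_∈_)
open import Data.List.Membership.Propositional.Properties using (∈-filter⁺; ∈-upTo⁺; ∈-++⁻)
import Data.List.Membership.DecPropositional as DecMembership
open import Relation.Binary.Core using (Rel)
open import Relation.Binary.Bundles using (TotalOrder)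
open import Relation.Binary.Definitions using (DecidableEquality; tri<; tri≈; tri>)
open import Relation.Binary.Lattice.Structures using (IsDistributiveLattice)
open import Relation.Binary.PropositionalEquality
  using (_≡_; _≢_; refl; sym; trans; cong; cong₂; subst; subst₂; isEquivalence; module ≡-Reasoning)
open import Relation.Nullary using (Dec; yes; no; ¬_; ¬?)
open import Relation.Nullary.Decidable using (map′; _×-dec_)
open import Relation.Nullary.Negation using (contradiction)

open import Defs

-- Distributive lattices

module _ {a ℓ₁ ℓ₂} (O : TotalOrder a ℓ₁ ℓ₂) where
  private
    module O  = TotalOrder O
    module MM = MinMaxOp (Min.minOperator O) (Max.maxOperator O)

  totalOrder-isDistributiveLattice : IsDistributiveLattice O._≈_ O._≤_ (Max._⊔_ O) (Min._⊓_ O)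
  totalOrder-isDistributiveLattice = record
    { isLattice = record
      { isPartialOrder = O.isPartialOrder
      ; supremum       = λ x y → MM.x≤x⊔y x y , MM.x≤y⊔x x y , λ _ → MM.⊔-lub
      ; infimum        = λ x y → MM.x⊓y≤x x y , MM.x⊓y≤y x y , λ _ → MM.⊓-glb
      }
    ; ∧-distribˡ-∨ = MM.⊓-distribˡ-⊔
    }

module _ {A B : Set} {_≤A_ : Rel A 0ℓ} {_≤B_ : Rel B 0ℓ}
         {_∨A_ _∧A_ : Op₂ A} {_∨B_ _∧B_ : Op₂ B}
         (LA : IsDistributiveLattice _≡_ _≤A_ _∨A_ _∧A_)
         (LB : IsDistributiveLattice _≡_ _≤B_ _∨B_ _∧B_) where
  private
    module LA = IsDistributiveLattice LA
    module LB = IsDistributiveLattice LB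

  _∨×_ : Op₂ (A × B)
  (x , y) ∨× (x' , y') = x ∨A x' , y ∨B y'

  _∧×_ : Op₂ (A × B)
  (x , y) ∧× (x' , y') = x ∧A x' , y ∧B y'

  ×-isDistributiveLattice : IsDistributiveLattice _≡_ (ProdOrd _≤A_ _≤B_) _∨×_ _∧×_
  ×-isDistributiveLattice = record
    { isLattice = record
      { isPartialOrder = record
        { isPreorder = record
          { isEquivalence = isEquivalence
          ; reflexive     = λ { refl → LA.refl , LB.refl }
          ; trans         = λ { (p , q) (p' , q') → LA.trans p p' , LB.trans q q' }
          }
        ; antisym = λ { (p , q) (p' , q') → cong₂ _,_ (LA.antisym p p') (LB.antisym q q') }
        }
      ; supremum = λ { (x , y) (x' , y') →
            (LA.x≤x∨y x x' , LB.x≤x∨y y y') , (LA.y≤x∨y x x' , LB.y≤x∨y y y') ,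
            λ { _ (p , q) (p' , q') → LA.∨-least p p' , LB.∨-least q q' } }
      ; infimum = λ { (x , y) (x' , y') →
            (LA.x∧y≤x x x' , LB.x∧y≤x y y') , (LA.x∧y≤y x x' , LB.x∧y≤y y y') ,
            λ { _ (p , q) (p' , q') → LA.∧-greatest p p' , LB.∧-greatest q q' } }
      }
    ; ∧-distribˡ-∨ = λ { (x , y) (x' , y') (x'' , y'') →
        cong₂ _,_ (LA.∧-distribˡ-∨ x x' x'') (LB.∧-distribˡ-∨ y y' y'') }
    }

  _∨⊕_ : Op₂ (A ⊎ B)
  inj₁ x ∨⊕ inj₁ y = inj₁ (x ∨A y)
  inj₁ _ ∨⊕ inj₂ y = inj₂ y
  inj₂ x ∨⊕ inj₁ _ = inj₂ x
  inj₂ x ∨⊕ inj₂ y = inj₂ (x ∨B y)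

  _∧⊕_ : Op₂ (A ⊎ B)
  inj₁ x ∧⊕ inj₁ y = inj₁ (x ∧A y)
  inj₁ x ∧⊕ inj₂ _ = inj₁ x
  inj₂ _ ∧⊕ inj₁ y = inj₁ y
  inj₂ x ∧⊕ inj₂ y = inj₂ (x ∧B y)

  private
    _⊑_ : Rel (A ⊎ B) 0ℓ
    _⊑_ = SumOrd _≤A_ _≤B_

    ⊑-reflexive : ∀ {u v} → u ≡ v → u ⊑ v
    ⊑-reflexive {inj₁ _} refl = LA.refl
    ⊑-reflexive {inj₂ _} refl = LB.refl

    ⊑-trans : ∀ {u v w} → u ⊑ v → v ⊑ w → u ⊑ w
    ⊑-trans {inj₁ _} {inj₁ _} {inj₁ _} p q = LA.trans p q
    ⊑-trans {inj₁ _} {inj₁ _} {inj₂ _} _ _ = tt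
    ⊑-trans {inj₁ _} {inj₂ _} {inj₂ _} _ _ = tt
    ⊑-trans {inj₂ _} {inj₂ _} {inj₂ _} p q = LB.trans p q

    ⊑-antisym : ∀ {u v} → u ⊑ v → v ⊑ u → u ≡ v
    ⊑-antisym {inj₁ _} {inj₁ _} p q = cong inj₁ (LA.antisym p q)
    ⊑-antisym {inj₂ _} {inj₂ _} p q = cong inj₂ (LB.antisym p q)

    ∨⊕-supremum : ∀ u v → u ⊑ (u ∨⊕ v) × v ⊑ (u ∨⊕ v) × (∀ w → u ⊑ w → v ⊑ w → (u ∨⊕ v) ⊑ w)
    ∨⊕-supremum (inj₁ x) (inj₁ y) = LA.x≤x∨y x y , LA.y≤x∨y x y ,
      λ { (inj₁ _) p q → LA.∨-least p q ; (inj₂ _) _ _ → tt }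
    ∨⊕-supremum (inj₁ _) (inj₂ _) = tt , LB.refl , λ { (inj₂ _) _ q → q }
    ∨⊕-supremum (inj₂ _) (inj₁ _) = LB.refl , tt , λ { (inj₂ _) p _ → p }
    ∨⊕-supremum (inj₂ x) (inj₂ y) = LB.x≤x∨y x y , LB.y≤x∨y x y ,
      λ { (inj₂ _) p q → LB.∨-least p q }

    ∧⊕-infimum : ∀ u v → (u ∧⊕ v) ⊑ u × (u ∧⊕ v) ⊑ v × (∀ w → w ⊑ u → w ⊑ v → w ⊑ (u ∧⊕ v))
    ∧⊕-infimum (inj₁ x) (inj₁ y) = LA.x∧y≤x x y , LA.x∧y≤y x y ,
      λ { (inj₁ _) p q → LA.∧-greatest p q }
    ∧⊕-infimum (inj₁ _) (inj₂ _) = LA.refl , tt , λ { (inj₁ _) p _ → p }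
    ∧⊕-infimum (inj₂ _) (inj₁ _) = tt , LA.refl , λ { (inj₁ _) _ q → q }
    ∧⊕-infimum (inj₂ x) (inj₂ y) = LB.x∧y≤x x y , LB.x∧y≤y x y ,
      λ { (inj₁ _) _ _ → tt ; (inj₂ _) p q → LB.∧-greatest p q }

    [x∧y]∨x≡x : ∀ x y → (x ∧A y) ∨A x ≡ x
    [x∧y]∨x≡x x y = LA.antisym (LA.∨-least (LA.x∧y≤x x y) LA.refl) (LA.y≤x∨y _ x)

    x∨[x∧y]≡x : ∀ x y → x ∨A (x ∧A y) ≡ x
    x∨[x∧y]≡x x y = LA.antisym (LA.∨-least LA.refl (LA.x∧y≤x x y)) (LA.x≤x∨y x _)

    x∨x≡x : ∀ x → x ∨A x ≡ x
    x∨x≡x x = LA.antisym (LA.∨-least LA.refl LA.refl) (LA.x≤x∨y x x)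

    ∧⊕-distribˡ-∨⊕ : ∀ u v w → (u ∧⊕ (v ∨⊕ w)) ≡ ((u ∧⊕ v) ∨⊕ (u ∧⊕ w))
    ∧⊕-distribˡ-∨⊕ (inj₁ x) (inj₁ y) (inj₁ z) = cong inj₁ (LA.∧-distribˡ-∨ x y z)
    ∧⊕-distribˡ-∨⊕ (inj₁ x) (inj₁ y) (inj₂ _) = cong inj₁ (sym ([x∧y]∨x≡x x y))
    ∧⊕-distribˡ-∨⊕ (inj₁ x) (inj₂ _) (inj₁ z) = cong inj₁ (sym (x∨[x∧y]≡x x z))
    ∧⊕-distribˡ-∨⊕ (inj₁ x) (inj₂ _) (inj₂ _) = cong inj₁ (sym (x∨x≡x x))
    ∧⊕-distribˡ-∨⊕ (inj₂ _) (inj₁ _) (inj₁ _) = refl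
    ∧⊕-distribˡ-∨⊕ (inj₂ _) (inj₁ _) (inj₂ _) = refl
    ∧⊕-distribˡ-∨⊕ (inj₂ _) (inj₂ _) (inj₁ _) = refl
    ∧⊕-distribˡ-∨⊕ (inj₂ x) (inj₂ y) (inj₂ z) = cong inj₂ (LB.∧-distribˡ-∨ x y z)

  ⊕-isDistributiveLattice : IsDistributiveLattice _≡_ (SumOrd _≤A_ _≤B_) _∨⊕_ _∧⊕_
  ⊕-isDistributiveLattice = record
    { isLattice = record
      { isPartialOrder = record
        { isPreorder = record
          { isEquivalence = isEquivalence
          ; reflexive     = ⊑-reflexive
          ; trans         = λ {u} {v} {w} → ⊑-trans {u} {v} {w}
          }
        ; antisym = ⊑-antisym
        }
      ; supremum = ∨⊕-supremum
      ; infimum  = ∧⊕-infimum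
      }
    ; ∧-distribˡ-∨ = ∧⊕-distribˡ-∨⊕
    }

chain-isDistributiveLattice : ∀ n → IsDistributiveLattice _≡_ (ChainOrd n)
                                (Max._⊔_ (Fin.≤-totalOrder n)) (Min._⊓_ (Fin.≤-totalOrder n))
chain-isDistributiveLattice n = totalOrder-isDistributiveLattice (Fin.≤-totalOrder n)

Ord-isDistributiveLatticePoset : ∀ p m n q → IsDistributiveLatticePoset (Ord p m n q)
Ord-isDistributiveLatticePoset p m n q = _ , _ ,
  ⊕-isDistributiveLattice (chain-isDistributiveLattice p)
    (⊕-isDistributiveLattice (×-isDistributiveLattice (chain-isDistributiveLattice m) (chain-isDistributiveLattice n))
                             (chain-isDistributiveLattice q))

𝟙 : {P : Set} → Dec P → ℕ
𝟙 (yes _) = 1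
𝟙 (no _)  = 0

𝟙≤1 : {P : Set} (d : Dec P) → 𝟙 d ≤ 1
𝟙≤1 (yes _) = s≤s z≤n
𝟙≤1 (no _)  = z≤n

𝟙-yes : {P : Set} → P → (d : Dec P) → 𝟙 d ≡ 1
𝟙-yes _ (yes _) = refl
𝟙-yes p (no ¬p) = contradiction p ¬p

𝟙-no : {P : Set} → ¬ P → (d : Dec P) → 𝟙 d ≡ 0
𝟙-no ¬p (yes p) = contradiction p ¬p
𝟙-no _  (no _)  = refl

𝟙-mono : {P Q : Set} → (P → Q) → (d : Dec P) (e : Dec Q) → 𝟙 d ≤ 𝟙 e
𝟙-mono _   (no _)  _       = z≤n
𝟙-mono _   (yes _) (yes _) = ≤-refl
𝟙-mono P⇒Q (yes p) (no ¬q) = contradiction (P⇒Q p) ¬q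

𝟙-≟-comm : ∀ m n → 𝟙 (m ≟ n) ≡ 𝟙 (n ≟ m)
𝟙-≟-comm m n with m ≟ n | n ≟ m
... | yes _ | yes _  = refl
... | yes e | no ne  = contradiction (sym e) ne
... | no ne | yes e  = contradiction (sym e) ne
... | no _  | no _   = refl

𝟙-<-suc : ∀ m n → 𝟙 (m <? suc n) ≡ 𝟙 (m <? n) + 𝟙 (m ≟ n)
𝟙-<-suc m n with m <? suc n | m <? n | m ≟ n
... | yes _   | yes _   | no _   = refl
... | yes _   | no _    | yes _  = refl
... | no _    | no _    | no _   = refl
... | yes _   | yes m<n | yes e  = contradiction e (<⇒≢ m<n)
... | yes m≤n | no m≮n  | no m≢n = contradiction (≤-antisym (≤-pred m≤n) (≮⇒≥ m≮n)) m≢n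
... | no m≮n  | yes m<n | _      = contradiction (m<n⇒m<1+n m<n) m≮n
... | no m≮n  | no _    | yes e  = contradiction (s≤s (≤-reflexive e)) m≮n

𝟙-≤?-split : ∀ n ℓ → 𝟙 (n ≤? ℓ) ≡ 𝟙 (suc n ≤? ℓ) + 𝟙 (ℓ ≟ n)
𝟙-≤?-split n ℓ with n ≤? ℓ | suc n ≤? ℓ | ℓ ≟ n
... | yes _   | yes _   | no _   = refl
... | yes _   | no _    | yes _  = refl
... | no _    | no _    | no _   = refl
... | yes _   | yes n<ℓ | yes e  = contradiction (sym e) (<⇒≢ n<ℓ)
... | yes n≤ℓ | no n≮ℓ  | no ℓ≢n = contradiction (≤-antisym (≮⇒≥ n≮ℓ) n≤ℓ) ℓ≢n
... | no n≰ℓ  | yes n<ℓ | _      = contradiction (<⇒≤ n<ℓ) n≰ℓ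
... | no n≰ℓ  | no _    | yes e  = contradiction (≤-reflexive (sym e)) n≰ℓ

∑ : ℕ → (ℕ → ℕ) → ℕ
∑ zero    g = 0
∑ (suc N) g = ∑ N g + g N

∑-cong : ∀ N {g h : ℕ → ℕ} → (∀ ℓ → ℓ < N → g ℓ ≡ h ℓ) → ∑ N g ≡ ∑ N h
∑-cong zero    _ = refl
∑-cong (suc N) e = cong₂ _+_ (∑-cong N λ ℓ l → e ℓ (m<n⇒m<1+n l)) (e N ≤-refl)

∑-mono-≤ : ∀ N {g h : ℕ → ℕ} → (∀ ℓ → ℓ < N → g ℓ ≤ h ℓ) → ∑ N g ≤ ∑ N h
∑-mono-≤ zero    _ = z≤n
∑-mono-≤ (suc N) e = +-mono-≤ (∑-mono-≤ N λ ℓ l → e ℓ (m<n⇒m<1+n l)) (e N ≤-refl)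

∑-distrib-+ : ∀ N (g h : ℕ → ℕ) → ∑ N (λ ℓ → g ℓ + h ℓ) ≡ ∑ N g + ∑ N h
∑-distrib-+ zero    g h = refl
∑-distrib-+ (suc N) g h rewrite ∑-distrib-+ N g h = +-exchange (∑ N g) (∑ N h) (g N) (h N)
  where
  +-exchange : ∀ w x y z → w + x + (y + z) ≡ w + y + (x + z)
  +-exchange w x y z rewrite +-assoc w x (y + z) | +-assoc w y (x + z)
    | sym (+-assoc x y z) | +-comm x y | +-assoc y x z = refl

∑-zero : ∀ N {g : ℕ → ℕ} → (∀ ℓ → ℓ < N → g ℓ ≡ 0) → ∑ N g ≡ 0
∑-zero N {g} e = trans (∑-cong N e) (∑-const0 N)
  where
  ∑-const0 : ∀ N → ∑ N (λ _ → 0) ≡ 0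
  ∑-const0 zero    = refl
  ∑-const0 (suc N) = trans (+-identityʳ _) (∑-const0 N)

∑-≥-term : ∀ N (g : ℕ → ℕ) {ℓ} → ℓ < N → g ℓ ≤ ∑ N g
∑-≥-term (suc N) g {ℓ} l with m≤n⇒m<n∨m≡n (≤-pred l)
... | inj₁ ℓ<N = ≤-trans (∑-≥-term N g ℓ<N) (m≤m+n _ _)
... | inj₂ refl = m≤n+m (g ℓ) (∑ ℓ g)

∑-𝟙-≡ : ∀ N u → ∑ N (λ ℓ → 𝟙 (ℓ ≟ u)) ≡ 𝟙 (u <? N)
∑-𝟙-≡ zero    u = refl
∑-𝟙-≡ (suc N) u = begin
  ∑ N (λ ℓ → 𝟙 (ℓ ≟ u)) + 𝟙 (N ≟ u) ≡⟨ cong₂ _+_ (∑-𝟙-≡ N u) (𝟙-≟-comm N u) ⟩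
  𝟙 (u <? N) + 𝟙 (u ≟ N)             ≡⟨ sym (𝟙-<-suc u N) ⟩
  𝟙 (u <? suc N)                     ∎
  where open ≡-Reasoning

crossing : (g : ℕ → ℕ) {x : ℕ} → x ≤ g 0 → ∀ K → ¬ x ≤ g K →
           ∃[ j ] (x ≤ g j × ¬ x ≤ g (suc j))
crossing g x≤g0 zero    x≰gK = contradiction x≤g0 x≰gK
crossing g {x} x≤g0 (suc K) x≰gK with x ≤? g K
... | yes x≤gK = K , x≤gK , x≰gK
... | no  x≰gK = crossing g x≤g0 K x≰gK

unitStep-ivt : (g : ℕ → ℕ) → g 0 ≡ 0 → (∀ i → g (suc i) ≤ suc (g i)) →
               ∀ M {y} → y ≤ g M → ∃[ i ] (i ≤ M × g i ≡ y)
unitStep-ivt g g0 step zero    {y} y≤g0 = 0 , z≤n , trans g0 (sym (n≤0⇒n≡0 (subst (y ≤_) g0 y≤g0)))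
unitStep-ivt g g0 step (suc M) {y} y≤gM with y ≤? g M
... | yes y≤g = let i , i≤M , gi≡y = unitStep-ivt g g0 step M y≤g in i , m≤n⇒m≤1+n i≤M , gi≡y
... | no  y≰g = suc M , ≤-refl , ≤-antisym (≤-trans (step M) (≰⇒> y≰g)) y≤gM

module _ {A : Set} {R : A → A → Set} where

  AllPairs-++⁻ˡ : ∀ xs {ys} → AllPairs R (xs ++ ys) → AllPairs R xs
  AllPairs-++⁻ˡ []       _           = []
  AllPairs-++⁻ˡ (x ∷ xs) (px ∷ pxs) = All.++⁻ˡ xs px ∷ AllPairs-++⁻ˡ xs pxs

  AllPairs-++⁻ʳ : ∀ xs {ys} → AllPairs R (xs ++ ys) → AllPairs R ys
  AllPairs-++⁻ʳ []       p          = p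
  AllPairs-++⁻ʳ (_ ∷ xs) (_ ∷ pxs) = AllPairs-++⁻ʳ xs pxs

length-filter-∷ : ∀ {A : Set} {P : A → Set} (P? : ∀ x → Dec (P x)) x xs →
                  length (filter P? (x ∷ xs)) ≡ 𝟙 (P? x) + length (filter P? xs)
length-filter-∷ P? x xs with P? x
... | yes _ = refl
... | no _  = refl

module _ {A : Set} (_≟A_ : DecidableEquality A) where

  private
    without : A → List A → List A
    without z = filter (λ w → ¬? (z ≟A w))

    length-without< : ∀ {z} ys → z ∈ ys → length (without z ys) < length ys
    length-without< {z} ys z∈ys = filter-notAll (λ w → ¬? (z ≟A w)) ys (Any.map (λ e z≢w → z≢w e) z∈ys)

  Unique-⊆⇒length≤ : ∀ xs ys → Unique xs → (∀ {z} → z ∈ xs → z ∈ ys) → length xs ≤ length ys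
  Unique-⊆⇒length≤ []       ys _            _    = z≤n
  Unique-⊆⇒length≤ (x ∷ xs) ys (x∉xs ∷ uxs) xs⊆ys =
    ≤-trans (s≤s (Unique-⊆⇒length≤ xs (without x ys) uxs xs⊆ys-x)) (length-without< ys (xs⊆ys (here refl)))
    where
    xs⊆ys-x : ∀ {z} → z ∈ xs → z ∈ without x ys
    xs⊆ys-x z∈xs = ∈-filter⁺ _ (xs⊆ys (there z∈xs)) (All.lookup x∉xs z∈xs)

  Unique-length≥⇒complete : ∀ xs ys → Unique xs → (∀ z → z ∈ ys) → length ys ≤ length xs → ∀ z → z ∈ xs
  Unique-length≥⇒complete xs ys uxs complete ys≤xs z with DecMembership._∈?_ _≟A_ z xs
  ... | yes z∈xs = z∈xs
  ... | no  z∉xs = contradiction ys≤xs (<⇒≱ (≤-<-trans xs≤ys-z (length-without< ys (complete z))))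
    where
    xs≤ys-z : length xs ≤ length (without z ys)
    xs≤ys-z = Unique-⊆⇒length≤ xs _ uxs λ {w} w∈xs →
      ∈-filter⁺ _ (complete w) λ z≡w → z∉xs (subst (_∈ xs) (sym z≡w) w∈xs)

Unique-<⇒length≤ : ∀ N (ns : List ℕ) → Unique ns → All (_< N) ns → length ns ≤ N
Unique-<⇒length≤ N ns uns ns<N = subst (length ns ≤_) (length-upTo N)
  (Unique-⊆⇒length≤ _≟_ ns (upTo N) uns λ n∈ns → ∈-upTo⁺ (All.lookup ns<N n∈ns))

-- Mountains

UnitRise : ℕ → ℕ → Set
UnitRise x y = x ≤ y × y ≤ suc x

Mountain : ℕ → (ℕ → ℕ) → Set
Mountain c f = (∀ ℓ → ℓ < c → UnitRise (f ℓ) (f (suc ℓ)))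
             × (∀ ℓ → c ≤ ℓ → UnitRise (f (suc ℓ)) (f ℓ))

UnitRise-mono : (h : ℕ → ℕ) → (∀ s → UnitRise (h s) (h (suc s))) →
                ∀ {t t′} → t ≤ t′ → h t ≤ h t′ × t ∸ h t ≤ t′ ∸ h t′
UnitRise-mono h step {t} {zero}   z≤n = ≤-refl , ≤-refl
UnitRise-mono h step {t} {suc s} t≤1+s with m≤n⇒m<n∨m≡n t≤1+s
... | inj₂ refl  = ≤-refl , ≤-refl
... | inj₁ t<1+s =
  let h-mono , col-mono = UnitRise-mono h step (≤-pred t<1+s)
      rise , rise≤1     = step s
  in ≤-trans h-mono rise , ≤-trans col-mono (∸-monoʳ-≤ (suc s) rise≤1)

UnitRise-⊓ : ∀ x y → UnitRise (x ⊓ y) (suc x ⊓ y)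
UnitRise-⊓ x zero    rewrite ⊓-zeroʳ x | ⊓-zeroʳ (suc x) = z≤n , z≤n
UnitRise-⊓ x (suc y) = ⊓-monoˡ-≤ (suc y) (n≤1+n x) , s≤s (⊓-monoʳ-≤ x (n≤1+n y))

UnitRise-∸ : ∀ {x x′} d → UnitRise x x′ → UnitRise (x′ ∸ d) (suc x ∸ d)
UnitRise-∸ {x} {x′} d (x≤x′ , x′≤1+x) =
  ∸-monoˡ-≤ d x′≤1+x , ≤-trans (1+m∸n≤1+[m∸n] x d) (s≤s (∸-monoˡ-≤ d x≤x′))
  where
  1+m∸n≤1+[m∸n] : ∀ m n → suc m ∸ n ≤ suc (m ∸ n)
  1+m∸n≤1+[m∸n] m       zero    = ≤-refl
  1+m∸n≤1+[m∸n] zero    (suc n) rewrite 0∸n≡0 n = z≤n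
  1+m∸n≤1+[m∸n] (suc m) (suc n) = 1+m∸n≤1+[m∸n] m n

Mountain-shift : ∀ {p c f} → Mountain (p + c) f → Mountain c (λ t → f (p + t))
Mountain-shift {p} {c} {f} (up , down) =
  (λ t t<c → subst (λ s → UnitRise (f (p + t)) (f s)) (sym (+-suc p t)) (up (p + t) (+-monoʳ-< p t<c))) ,
  (λ t c≤t → subst (λ s → UnitRise (f s) (f (p + t))) (sym (+-suc p t)) (down (p + t) (+-monoʳ-≤ p c≤t)))

UnitRise⇒≡∨≡suc : ∀ {x y} → UnitRise x y → y ≡ x ⊎ y ≡ suc x
UnitRise⇒≡∨≡suc (x≤y , y≤1+x) with m≤n⇒m<n∨m≡n x≤y
... | inj₁ x<y = inj₂ (≤-antisym y≤1+x x<y)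
... | inj₂ x≡y = inj₁ (sym x≡y)

cut : ℕ → ℕ → ℕ → ℕ
cut k s z = 𝟙 (k <? z) + 𝟙 (z ≟ k) * s

lower : ℕ → ℕ → ℕ → ℕ
lower k s z = z ∸ cut k s z

cut-< : ∀ {k z} s → z < k → cut k s z ≡ 0
cut-< {k} {z} s z<k rewrite 𝟙-no (<⇒≯ z<k) (k <? z) | 𝟙-no (<⇒≢ z<k) (z ≟ k) = refl

cut-≡ : ∀ k s → cut k s k ≡ s
cut-≡ k s rewrite 𝟙-no (<-irrefl refl) (k <? k) | 𝟙-yes refl (k ≟ k) = +-identityʳ s

cut-> : ∀ {k z} s → k < z → cut k s z ≡ 1
cut-> {k} {z} s k<z rewrite 𝟙-yes k<z (k <? z) | 𝟙-no (>⇒≢ k<z) (z ≟ k) = refl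

cut≤1 : ∀ k {s} z → s ≤ 1 → cut k s z ≤ 1
cut≤1 k {s} z s≤1 with <-cmp z k
... | tri< z<k _ _    rewrite cut-< s z<k = z≤n
... | tri≈ _ refl _  rewrite cut-≡ k s = s≤1
... | tri> _ _ k<z    rewrite cut-> s k<z = ≤-refl

cut≤ : ∀ {k} s z → 1 ≤ k → s ≤ 1 → cut k s z ≤ z
cut≤ {k} s z 1≤k s≤1 with <-cmp z k
... | tri< z<k _ _    rewrite cut-< s z<k = z≤n
... | tri≈ _ refl _  rewrite cut-≡ k s = ≤-trans s≤1 1≤k
... | tri> _ _ k<z    rewrite cut-> s k<z = ≤-trans (s≤s z≤n) k<z

cut≡1⇒k≤z : ∀ {k} s z → cut k s z ≡ 1 → k ≤ z
cut≡1⇒k≤z {k} s z cut≡1 with <-cmp z k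
... | tri< z<k _ _ rewrite cut-< s z<k = contradiction cut≡1 λ ()
... | tri≈ _ z≡k _ = ≤-reflexive (sym z≡k)
... | tri> _ _ k<z = <⇒≤ k<z

lower-< : ∀ {k z} s → z < k → lower k s z ≡ z
lower-< {z = z} s z<k = cong (z ∸_) (cut-< s z<k)

lower-≡ : ∀ k s → lower k s k ≡ k ∸ s
lower-≡ k s = cong (k ∸_) (cut-≡ k s)

lower-> : ∀ {k z} s → k < z → lower k s z ≡ pred z
lower-> {z = z} s k<z = cong (z ∸_) (cut-> s k<z)

private
  m≤[1+m]∸s : ∀ m {s} → s ≤ 1 → m ≤ suc m ∸ s
  m≤[1+m]∸s m s≤1 = ∸-monoʳ-≤ (suc m) s≤1

  m≤1+[m∸s] : ∀ m {s} → s ≤ 1 → m ≤ suc (m ∸ s)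
  m≤1+[m∸s] m {s} s≤1 = ≤-trans (m≤n+m∸n m s) (+-monoˡ-≤ (m ∸ s) s≤1)

lower-UnitRise : ∀ k {x y sx sy} → UnitRise x y → sy ≤ sx → sx ≤ 1 →
                 UnitRise (lower k sx x) (lower k sy y)
lower-UnitRise k {x} {sx = sx} {sy} rise sy≤sx sx≤1 with UnitRise⇒≡∨≡suc rise | <-cmp x k
... | inj₁ refl | tri< x<k _ _ rewrite lower-< sx x<k | lower-< sy x<k = ≤-refl , n≤1+n x
... | inj₁ refl | tri≈ _ refl _ rewrite lower-≡ k sx | lower-≡ k sy =
  ∸-monoʳ-≤ k sy≤sx , ≤-trans (m∸n≤m k sy) (m≤1+[m∸s] k sx≤1)
... | inj₁ refl | tri> _ _ k<x rewrite lower-> sx k<x | lower-> sy k<x = ≤-refl , n≤1+n (pred x)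
... | inj₂ refl | tri≈ _ refl _ rewrite lower-≡ k sx | lower-> sy (n<1+n k) =
  m∸n≤m k sx , m≤1+[m∸s] k sx≤1
... | inj₂ refl | tri> _ _ k<x rewrite lower-> sx k<x | lower-> sy (m<n⇒m<1+n k<x) =
  pred[n]≤n , m≤n+m∸n x 1
... | inj₂ refl | tri< x<k _ _ with m≤n⇒m<n∨m≡n x<k
...   | inj₁ 1+x<k rewrite lower-< sx x<k | lower-< sy 1+x<k = n≤1+n x , ≤-refl
...   | inj₂ refl  rewrite lower-< sx x<k | lower-≡ (suc x) sy =
  m≤[1+m]∸s x (≤-trans sy≤sx sx≤1) , m∸n≤m (suc x) sy

lower-Mountain : ∀ {c f} k (σ : ℕ → ℕ) → Mountain c f → (∀ ℓ → σ ℓ ≤ 1) →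
                 (∀ ℓ → ℓ < c → σ (suc ℓ) ≤ σ ℓ) → (∀ ℓ → c ≤ ℓ → σ ℓ ≤ σ (suc ℓ)) →
                 Mountain c (λ ℓ → lower k (σ ℓ) (f ℓ))
lower-Mountain k σ (up , down) σ≤1 σ-left σ-right =
  (λ ℓ ℓ<c → lower-UnitRise k (up ℓ ℓ<c) (σ-left ℓ ℓ<c) (σ≤1 ℓ)) ,
  (λ ℓ c≤ℓ → lower-UnitRise k (down ℓ c≤ℓ) (σ-right ℓ c≤ℓ) (σ≤1 (suc ℓ)))

-- Lowering a mountain profile by one element on each of x levels

module _ (N c : ℕ) (f : ℕ → ℕ) where

  record Selection (k d : ℕ) : Set where
    field
      σ       : ℕ → ℕ
      σ≤1     : ∀ ℓ → σ ℓ ≤ 1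
      σ-left  : ∀ ℓ → ℓ < c → σ (suc ℓ) ≤ σ ℓ
      σ-right : ∀ ℓ → c ≤ ℓ → σ ℓ ≤ σ (suc ℓ)
      ∑σ≡d    : ∑ N (λ ℓ → 𝟙 (f ℓ ≟ k) * σ ℓ) ≡ d

  record Decrement (x : ℕ) : Set where
    field
      t             : ℕ → ℕ
      threshold     : ℕ
      t≤1           : ∀ ℓ → t ℓ ≤ 1
      t≤f           : ∀ ℓ → t ℓ ≤ f ℓ
      t≡1⇒thr≤f     : ∀ ℓ → t ℓ ≡ 1 → threshold ≤ f ℓ
      thr<f⇒t≡1     : ∀ ℓ → threshold < f ℓ → t ℓ ≡ 1
      ∑t≡x          : ∑ N t ≡ x
      mountain      : Mountain c (λ ℓ → f ℓ ∸ t ℓ)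

Fits : ℕ → (ℕ → ℕ) → List ℕ → Set
Fits N f μ = ∀ k → sum (take k μ) ≤ ∑ N (λ ℓ → k ⊓ f ℓ)

private
  k⊓[z∸s]≡k⊓z : ∀ {k thr z s} → k < thr → s ≤ 1 → (s ≡ 1 → thr ≤ z) → k ⊓ (z ∸ s) ≡ k ⊓ z
  k⊓[z∸s]≡k⊓z {s = zero}  _   _ _ = refl
  k⊓[z∸s]≡k⊓z {k} {z = zero} {suc zero} k<thr _ thr≤z = contradiction (≤-trans k<thr (thr≤z refl)) λ ()
  k⊓[z∸s]≡k⊓z {k} {z = suc z} {suc zero} k<thr _ thr≤z =
    trans (m≤n⇒m⊓n≡m k≤z) (sym (m≤n⇒m⊓n≡m (m≤n⇒m≤1+n k≤z)))
    where
    k≤z : k ≤ z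
    k≤z = ≤-pred (≤-trans k<thr (thr≤z refl))
  k⊓[z∸s]≡k⊓z {s = suc (suc _)} _ (s≤s ()) _

  k⊓[z∸s]+s≡1+k⊓z : ∀ {k thr z s} → thr ≤ k → s ≤ 1 → s ≤ z → (thr < z → s ≡ 1) →
                    k ⊓ (z ∸ s) + s ≡ suc k ⊓ z
  k⊓[z∸s]+s≡1+k⊓z {k} {thr} {z} {zero} thr≤k _ _ s≡1 with thr <? z
  ... | yes thr<z = contradiction (s≡1 thr<z) λ ()
  ... | no  thr≮z = trans (+-identityʳ _) (trans (m≥n⇒m⊓n≡n z≤k) (sym (m≥n⇒m⊓n≡n (m≤n⇒m≤1+n z≤k))))
    where
    z≤k : z ≤ k
    z≤k = ≤-trans (≮⇒≥ thr≮z) thr≤k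
  k⊓[z∸s]+s≡1+k⊓z {k} {z = suc z} {suc zero} _ _ _ _ = +-comm (k ⊓ z) 1
  k⊓[z∸s]+s≡1+k⊓z {s = suc (suc _)} _ (s≤s ()) _ _

sum-take-tail≤ : ∀ {x μ} → Linked _≥_ (x ∷ μ) → ∀ k → sum (take k μ) ≤ sum (take k (x ∷ μ))
sum-take-tail≤ _           zero    = z≤n
sum-take-tail≤ [-]         (suc _) = z≤n
sum-take-tail≤ (x≥y ∷ lnk) (suc k) = +-mono-≤ x≥y (sum-take-tail≤ lnk k)

Fits-decrement : ∀ {N c f x μ} → Linked _≥_ (x ∷ μ) → Fits N f (x ∷ μ) →
                 (D : Decrement N c f x) → Fits N (λ ℓ → f ℓ ∸ Decrement.t D ℓ) μ
Fits-decrement {N} {c} {f} {x} {μ} lnk fits D k with k <? Decrement.threshold D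
... | yes k<thr = begin
  sum (take k μ)                     ≤⟨ sum-take-tail≤ lnk k ⟩
  sum (take k (x ∷ μ))               ≤⟨ fits k ⟩
  ∑ N (λ ℓ → k ⊓ f ℓ)
    ≡⟨ ∑-cong N (λ ℓ _ → sym (k⊓[z∸s]≡k⊓z k<thr (t≤1 ℓ) (t≡1⇒thr≤f ℓ))) ⟩
  ∑ N (λ ℓ → k ⊓ (f ℓ ∸ t ℓ))        ∎
  where open Decrement D; open ≤-Reasoning
... | no k≮thr = +-cancelˡ-≤ x _ _ (begin
  x + sum (take k μ)                 ≤⟨ fits (suc k) ⟩
  ∑ N (λ ℓ → suc k ⊓ f ℓ)
    ≡⟨ ∑-cong N (λ ℓ _ → sym (k⊓[z∸s]+s≡1+k⊓z (≮⇒≥ k≮thr) (t≤1 ℓ) (t≤f ℓ) (thr<f⇒t≡1 ℓ))) ⟩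
  ∑ N (λ ℓ → k ⊓ (f ℓ ∸ t ℓ) + t ℓ)  ≡⟨ ∑-distrib-+ N _ t ⟩
  ∑ N (λ ℓ → k ⊓ (f ℓ ∸ t ℓ)) + ∑ N t ≡⟨ cong (_ +_) ∑t≡x ⟩
  ∑ N (λ ℓ → k ⊓ (f ℓ ∸ t ℓ)) + x    ≡⟨ +-comm _ x ⟩
  x + ∑ N (λ ℓ → k ⊓ (f ℓ ∸ t ℓ))    ∎)
  where open Decrement D; open ≤-Reasoning

module _ {N c : ℕ} (c<N : c < N) {f : ℕ → ℕ} where

  private
    atLeft : ℕ → ℕ → ℕ
    atLeft k u = ∑ N (λ ℓ → 𝟙 (f ℓ ≟ k) * 𝟙 (ℓ <? u))

    atRight : ℕ → ℕ → ℕ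
    atRight k w = ∑ N (λ ℓ → 𝟙 (f ℓ ≟ k) * 𝟙 (N ∸ w ≤? ℓ))

    w₀ : ℕ
    w₀ = N ∸ suc c

    *-𝟙-≤ : ∀ e {a b z} → e ≤ 1 → a ≤ b + z → e * a ≤ e * b + z
    *-𝟙-≤ zero          _        _   = z≤n
    *-𝟙-≤ (suc zero) {a} {b} _ a≤b+z rewrite +-identityʳ a | +-identityʳ b = a≤b+z
    *-𝟙-≤ (suc (suc _)) (s≤s ()) _

    ∑-unitStep : ∀ {g h : ℕ → ℕ} u → (∀ ℓ → h ℓ ≤ g ℓ + 𝟙 (ℓ ≟ u)) → ∑ N h ≤ suc (∑ N g)
    ∑-unitStep {g} {h} u h≤g+δ = begin
      ∑ N h                               ≤⟨ ∑-mono-≤ N (λ ℓ _ → h≤g+δ ℓ) ⟩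
      ∑ N (λ ℓ → g ℓ + 𝟙 (ℓ ≟ u))         ≡⟨ ∑-distrib-+ N g _ ⟩
      ∑ N g + ∑ N (λ ℓ → 𝟙 (ℓ ≟ u))       ≡⟨ cong (∑ N g +_) (∑-𝟙-≡ N u) ⟩
      ∑ N g + 𝟙 (u <? N)                  ≤⟨ +-monoʳ-≤ (∑ N g) (𝟙≤1 (u <? N)) ⟩
      ∑ N g + 1                           ≡⟨ +-comm _ 1 ⟩
      suc (∑ N g)                         ∎
      where open ≤-Reasoning

    atLeft-0 : ∀ k → atLeft k 0 ≡ 0
    atLeft-0 k = ∑-zero N λ ℓ _ → *-zeroʳ (𝟙 (f ℓ ≟ k))

    atLeft-step : ∀ k u → atLeft k (suc u) ≤ suc (atLeft k u)
    atLeft-step k u = ∑-unitStep {λ ℓ → 𝟙 (f ℓ ≟ k) * 𝟙 (ℓ <? u)} u λ ℓ →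
      *-𝟙-≤ (𝟙 (f ℓ ≟ k)) (𝟙≤1 _) (≤-reflexive (𝟙-<-suc ℓ u))

    atRight-0 : ∀ k → atRight k 0 ≡ 0
    atRight-0 k = ∑-zero N λ ℓ ℓ<N →
      trans (cong (𝟙 (f ℓ ≟ k) *_) (𝟙-no (<⇒≱ ℓ<N) (N ≤? ℓ))) (*-zeroʳ (𝟙 (f ℓ ≟ k)))

    atRight-step : ∀ k w → atRight k (suc w) ≤ suc (atRight k w)
    atRight-step k w = ∑-unitStep {λ ℓ → 𝟙 (f ℓ ≟ k) * 𝟙 (N ∸ w ≤? ℓ)} (N ∸ suc w) λ ℓ →
      *-𝟙-≤ (𝟙 (f ℓ ≟ k)) (𝟙≤1 _) (begin
        𝟙 (N ∸ suc w ≤? ℓ)                            ≡⟨ 𝟙-≤?-split (N ∸ suc w) ℓ ⟩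
        𝟙 (suc (N ∸ suc w) ≤? ℓ) + 𝟙 (ℓ ≟ N ∸ suc w)
          ≤⟨ +-monoˡ-≤ _ (𝟙-mono (≤-trans (N∸w≤1+N∸1+w N w)) (suc (N ∸ suc w) ≤? ℓ) (N ∸ w ≤? ℓ)) ⟩
        𝟙 (N ∸ w ≤? ℓ) + 𝟙 (ℓ ≟ N ∸ suc w)            ∎)
      where
      open ≤-Reasoning
      N∸w≤1+N∸1+w : ∀ N w → N ∸ w ≤ suc (N ∸ suc w)
      N∸w≤1+N∸1+w zero    w       rewrite 0∸n≡0 w = z≤n
      N∸w≤1+N∸1+w (suc N) zero    = ≤-refl
      N∸w≤1+N∸1+w (suc N) (suc w) = N∸w≤1+N∸1+w N w

    𝟙-≤-peak-split : ∀ e ℓ → e ≤ 1 → e ≤ e * 𝟙 (ℓ <? c) + e * 𝟙 (suc c ≤? ℓ) + 𝟙 (ℓ ≟ c)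
    𝟙-≤-peak-split e ℓ e≤1 with ℓ <? c | suc c ≤? ℓ | ℓ ≟ c
    ... | yes _ | _     | _     rewrite *-identityʳ e = ≤-trans (m≤m+n e _) (m≤m+n _ _)
    ... | no _  | yes _ | _     rewrite *-identityʳ e = ≤-trans (m≤n+m e (e * 0)) (m≤m+n _ _)
    ... | no _  | no _  | yes _ = ≤-trans e≤1 (m≤n+m 1 _)
    ... | no ℓ≮c | no c≮ℓ | no ℓ≢c = contradiction (≤-antisym (≤-pred (≰⇒> c≮ℓ)) (≮⇒≥ ℓ≮c)) ℓ≢c

    -- the peak is the only level with value k that neither side counts
    at≤atLeft+atRight+1 : ∀ k → ∑ N (λ ℓ → 𝟙 (f ℓ ≟ k)) ≤ atLeft k c + atRight k w₀ + 1
    at≤atLeft+atRight+1 k = begin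
      ∑ N (λ ℓ → 𝟙 (f ℓ ≟ k))
        ≤⟨ ∑-mono-≤ N (λ ℓ _ → 𝟙-≤-peak-split (𝟙 (f ℓ ≟ k)) ℓ (𝟙≤1 _)) ⟩
      ∑ N (λ ℓ → 𝟙 (f ℓ ≟ k) * 𝟙 (ℓ <? c) + 𝟙 (f ℓ ≟ k) * 𝟙 (suc c ≤? ℓ) + 𝟙 (ℓ ≟ c))
        ≡⟨ trans (∑-distrib-+ N _ _) (cong₂ _+_ (∑-distrib-+ N _ _) (∑-𝟙-≡ N c)) ⟩
      atLeft k c + ∑ N (λ ℓ → 𝟙 (f ℓ ≟ k) * 𝟙 (suc c ≤? ℓ)) + 𝟙 (c <? N)
        ≡⟨ cong₂ (λ a b → atLeft k c + atRight′ a + b) (sym (m∸[m∸n]≡n c<N)) (𝟙-yes c<N _) ⟩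
      atLeft k c + atRight k w₀ + 1 ∎
      where
      open ≤-Reasoning
      atRight′ : ℕ → ℕ
      atRight′ v = ∑ N (λ ℓ → 𝟙 (f ℓ ≟ k) * 𝟙 (v ≤? ℓ))

  selectAll : ∀ k → Selection N c f k (∑ N (λ ℓ → 𝟙 (f ℓ ≟ k)))
  selectAll k = record
    { σ = λ _ → 1 ; σ≤1 = λ _ → ≤-refl ; σ-left = λ _ _ → ≤-refl ; σ-right = λ _ _ → ≤-refl
    ; ∑σ≡d = ∑-cong N λ ℓ _ → *-identityʳ _ }

  -- lower the leftmost levels before the peak and the rightmost ones after it
  selectTwoSided : ∀ {k d} → d ≤ atLeft k c + atRight k w₀ → Selection N c f k d
  selectTwoSided {k} {d} d≤ = record
    { σ = σ ; σ≤1 = σ≤1 ; σ-left = σ-left ; σ-right = σ-right ; ∑σ≡d = ∑σ≡d }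
    where
    d-atLeft≤atRight : d ∸ atLeft k c ≤ atRight k w₀
    d-atLeft≤atRight = ≤-trans (∸-monoˡ-≤ (atLeft k c) d≤) (≤-reflexive (m+n∸m≡n (atLeft k c) _))

    left : ∃[ u ] (u ≤ c × atLeft k u ≡ atLeft k c ⊓ d)
    left = unitStep-ivt (atLeft k) (atLeft-0 k) (atLeft-step k) c (m⊓n≤m (atLeft k c) d)

    right : ∃[ w ] (w ≤ w₀ × atRight k w ≡ d ∸ atLeft k c)
    right = unitStep-ivt (atRight k) (atRight-0 k) (atRight-step k) w₀ d-atLeft≤atRight

    u v : ℕ
    u = proj₁ left
    v = N ∸ proj₁ right

    u≤c : u ≤ c
    u≤c = proj₁ (proj₂ left)

    c<v : c < v
    c<v = ≤-trans (≤-reflexive (sym (m∸[m∸n]≡n c<N))) (∸-monoʳ-≤ N (proj₁ (proj₂ right)))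

    σ : ℕ → ℕ
    σ ℓ = 𝟙 (ℓ <? u) + 𝟙 (v ≤? ℓ)

    σ≤1 : ∀ ℓ → σ ℓ ≤ 1
    σ≤1 ℓ with ℓ <? u
    ... | yes ℓ<u rewrite 𝟙-no (<⇒≱ (<-≤-trans ℓ<u (≤-trans u≤c (<⇒≤ c<v)))) (v ≤? ℓ) = ≤-refl
    ... | no _    = 𝟙≤1 (v ≤? ℓ)

    σ-left : ∀ ℓ → ℓ < c → σ (suc ℓ) ≤ σ ℓ
    σ-left ℓ ℓ<c = +-mono-≤ (𝟙-mono (<-trans (n<1+n ℓ)) (suc ℓ <? u) (ℓ <? u))
      (𝟙-mono (λ v≤1+ℓ → contradiction (<-≤-trans c<v v≤1+ℓ) (≤⇒≯ ℓ<c)) (v ≤? suc ℓ) (v ≤? ℓ))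

    σ-right : ∀ ℓ → c ≤ ℓ → σ ℓ ≤ σ (suc ℓ)
    σ-right ℓ c≤ℓ =
      +-mono-≤ (𝟙-mono (λ ℓ<u → contradiction (≤-trans u≤c c≤ℓ) (<⇒≱ ℓ<u)) (ℓ <? u) (suc ℓ <? u))
      (𝟙-mono m≤n⇒m≤1+n (v ≤? ℓ) (v ≤? suc ℓ))

    ∑σ≡d : ∑ N (λ ℓ → 𝟙 (f ℓ ≟ k) * σ ℓ) ≡ d
    ∑σ≡d = begin
      ∑ N (λ ℓ → 𝟙 (f ℓ ≟ k) * σ ℓ)   ≡⟨ ∑-cong N (λ ℓ _ → *-distribˡ-+ (𝟙 (f ℓ ≟ k)) _ _) ⟩
      ∑ N (λ ℓ → 𝟙 (f ℓ ≟ k) * 𝟙 (ℓ <? u) + 𝟙 (f ℓ ≟ k) * 𝟙 (v ≤? ℓ))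
                                      ≡⟨ ∑-distrib-+ N _ _ ⟩
      atLeft k u + atRight k (proj₁ right)
                                      ≡⟨ cong₂ _+_ (proj₂ (proj₂ left)) (proj₂ (proj₂ right)) ⟩
      atLeft k c ⊓ d + (d ∸ atLeft k c) ≡⟨ m⊓n+n∸m≡n (atLeft k c) d ⟩
      d                               ∎
      where open ≡-Reasoning

  selection : ∀ {k d} → d ≤ ∑ N (λ ℓ → 𝟙 (f ℓ ≟ k)) → Selection N c f k d
  selection {k} {d} d≤at with d ≟ ∑ N (λ ℓ → 𝟙 (f ℓ ≟ k))
  ... | yes refl = selectAll k
  ... | no  d≢at = selectTwoSided (≤-pred (begin
    suc d                                   ≤⟨ ≤∧≢⇒< d≤at d≢at ⟩
    ∑ N (λ ℓ → 𝟙 (f ℓ ≟ k))                 ≤⟨ at≤atLeft+atRight+1 k ⟩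
    atLeft k c + atRight k w₀ + 1           ≡⟨ +-comm _ 1 ⟩
    suc (atLeft k c + atRight k w₀)         ∎))
    where open ≤-Reasoning

  private
    above : ℕ → ℕ
    above j = ∑ N (λ ℓ → 𝟙 (j <? f ℓ))

    above-split : ∀ j → above j ≡ above (suc j) + ∑ N (λ ℓ → 𝟙 (f ℓ ≟ suc j))
    above-split j = trans (∑-cong N λ ℓ _ → 𝟙-≤?-split (suc j) (f ℓ)) (∑-distrib-+ N _ _)

    above-∑ : above (∑ N f) ≡ 0
    above-∑ = ∑-zero N λ ℓ ℓ<N → 𝟙-no (≤⇒≯ (∑-≥-term N f ℓ<N)) (∑ N f <? f ℓ)

    1⊓z≡𝟙[0<z] : ∀ z → 1 ⊓ z ≡ 𝟙 (0 <? z)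
    1⊓z≡𝟙[0<z] zero    = refl
    1⊓z≡𝟙[0<z] (suc _) = refl

  -- the x levels of largest value, ties broken so that f stays a mountain
  decrement : Mountain c f → ∀ {x} → 1 ≤ x → x ≤ ∑ N (λ ℓ → 1 ⊓ f ℓ) → Decrement N c f x
  decrement mountain {x} 1≤x x≤#f>0 = record
    { t = t ; threshold = k
    ; t≤1 = λ ℓ → cut≤1 k (f ℓ) (σ≤1 ℓ)
    ; t≤f = λ ℓ → cut≤ (σ ℓ) (f ℓ) (s≤s z≤n) (σ≤1 ℓ)
    ; t≡1⇒thr≤f = λ ℓ → cut≡1⇒k≤z (σ ℓ) (f ℓ)
    ; thr<f⇒t≡1 = λ ℓ → cut-> (σ ℓ)
    ; ∑t≡x = ∑t≡x
    ; mountain = lower-Mountain k σ mountain σ≤1 σ-left σ-right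
    }
    where
    x≤above0 : x ≤ above 0
    x≤above0 = subst (x ≤_) (∑-cong N λ ℓ _ → 1⊓z≡𝟙[0<z] (f ℓ)) x≤#f>0

    cross : ∃[ j ] (x ≤ above j × ¬ x ≤ above (suc j))
    cross = crossing above x≤above0 (∑ N f) λ x≤ → contradiction (subst (x ≤_) above-∑ x≤) (<⇒≱ 1≤x)

    j k : ℕ
    j = proj₁ cross
    k = suc j

    d : ℕ
    d = x ∸ above k

    above-k+d≡x : above k + d ≡ x
    above-k+d≡x = m+[n∸m]≡n (<⇒≤ (≰⇒> (proj₂ (proj₂ cross))))

    d≤at : d ≤ ∑ N (λ ℓ → 𝟙 (f ℓ ≟ k))
    d≤at = +-cancelˡ-≤ (above k) _ _ (begin
      above k + d                          ≡⟨ above-k+d≡x ⟩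
      x                                    ≤⟨ proj₁ (proj₂ cross) ⟩
      above j                              ≡⟨ above-split j ⟩
      above k + ∑ N (λ ℓ → 𝟙 (f ℓ ≟ k))    ∎)
      where open ≤-Reasoning

    open Selection (selection d≤at)

    t : ℕ → ℕ
    t ℓ = cut k (σ ℓ) (f ℓ)

    ∑t≡x : ∑ N t ≡ x
    ∑t≡x = begin
      ∑ N t                                              ≡⟨ ∑-distrib-+ N _ _ ⟩
      above k + ∑ N (λ ℓ → 𝟙 (f ℓ ≟ k) * σ ℓ)            ≡⟨ cong (above k +_) ∑σ≡d ⟩
      above k + d                                        ≡⟨ above-k+d≡x ⟩
      x                                                  ∎
      where open ≡-Reasoning

-- Levelings and the greedy construction of chain partitions

-- The elements of rank below f ℓ are those
-- still available on level ℓ, and tops-≼ says that for a mountain f the first unavailable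
-- elements element ℓ (f ℓ) form a chain.
record Leveling {C : Set} (_≼_ : Rel C 0ℓ) : Set where
  field
    height peak        : ℕ
    peak<height        : peak < height
    width              : ℕ → ℕ
    width-mountain     : Mountain peak width
    level rank         : C → ℕ
    element            : ℕ → ℕ → C
    level<height       : ∀ x → level x < height
    rank<width         : ∀ x → rank x < width (level x)
    element-level-rank : ∀ x → element (level x) (rank x) ≡ x
    level-element      : ∀ {ℓ ρ} → ρ < width ℓ → level (element ℓ ρ) ≡ ℓ
    rank-element       : ∀ {ℓ ρ} → ρ < width ℓ → rank (element ℓ ρ) ≡ ρ
    ≼-level-injective  : ∀ {x y} → x ≼ y → level x ≡ level y → x ≡ y
    tops-≼             : ∀ {f} → Mountain peak f → ∀ {ℓ₁ ℓ₂} → ℓ₁ < ℓ₂ → ℓ₂ < height →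
                         f ℓ₁ < width ℓ₁ → f ℓ₂ < width ℓ₂ → element ℓ₁ (f ℓ₁) ≼ element ℓ₂ (f ℓ₂)

module LevelingProperties {C : Set} {_≼_ : Rel C 0ℓ} (L : Leveling _≼_) where
  open Leveling L

  level-rank-injective : ∀ {x y} → level x ≡ level y → rank x ≡ rank y → x ≡ y
  level-rank-injective {x} {y} eℓ eρ = begin
    x                          ≡⟨ sym (element-level-rank x) ⟩
    element (level x) (rank x) ≡⟨ cong₂ element eℓ eρ ⟩
    element (level y) (rank y) ≡⟨ element-level-rank y ⟩
    y                          ∎
    where open ≡-Reasoning

  _≟C_ : DecidableEquality C
  x ≟C y = map′ (λ (eℓ , eρ) → level-rank-injective eℓ eρ) (λ { refl → refl , refl })
                ((level x ≟ level y) ×-dec (rank x ≟ rank y))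

  Available : (ℕ → ℕ) → C → Set
  Available f x = rank x < f (level x)

  module Tops (t r : ℕ → ℕ) where

    topAt : ℕ → List C
    topAt ℓ with t ℓ ≟ 1
    ... | yes _ = element ℓ (r ℓ) ∷ []
    ... | no _  = []

    tops : ℕ → List C
    tops zero    = []
    tops (suc N) = tops N ++ topAt N

    length-tops : (∀ ℓ → t ℓ ≤ 1) → ∀ N → length (tops N) ≡ ∑ N t
    length-tops t≤1 zero    = refl
    length-tops t≤1 (suc N) = trans (length-++ (tops N)) (cong₂ _+_ (length-tops t≤1 N) length-topAt)
      where
      length-topAt : length (topAt N) ≡ t N
      length-topAt with t N ≟ 1
      ... | yes tN≡1 = sym tN≡1
      ... | no  tN≢1 = sym (n<1⇒n≡0 (≤∧≢⇒< (t≤1 N) tN≢1))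

    ∈-tops⁻ : ∀ N {y} → y ∈ tops N → ∃[ ℓ ] (ℓ < N × t ℓ ≡ 1 × y ≡ element ℓ (r ℓ))
    ∈-tops⁻ (suc N) y∈ with ∈-++⁻ (tops N) y∈
    ... | inj₁ y∈tops with ∈-tops⁻ N y∈tops
    ...   | ℓ , ℓ<N , tℓ≡1 , y≡ = ℓ , m<n⇒m<1+n ℓ<N , tℓ≡1 , y≡
    ∈-tops⁻ (suc N) y∈ | inj₂ y∈topAt with t N ≟ 1 | y∈topAt
    ... | yes tN≡1 | here y≡ = N , ≤-refl , tN≡1 , y≡

    AllPairs-tops : (R : C → C → Set) → ∀ N →
                    (∀ {ℓ₁ ℓ₂} → ℓ₁ < ℓ₂ → ℓ₂ < N → t ℓ₁ ≡ 1 → t ℓ₂ ≡ 1 →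
                       R (element ℓ₁ (r ℓ₁)) (element ℓ₂ (r ℓ₂))) →
                    AllPairs R (tops N)
    AllPairs-tops R zero    _   = []
    AllPairs-tops R (suc N) rel = AllPairs.++⁺ (AllPairs-tops R N λ l l' → rel l (m<n⇒m<1+n l')) AllPairs-topAt
      (All.tabulate λ y∈tops → R-topAt (∈-tops⁻ N y∈tops))
      where
      AllPairs-topAt : AllPairs R (topAt N)
      AllPairs-topAt with t N ≟ 1
      ... | yes _ = [] ∷ []
      ... | no _  = []

      R-topAt : ∀ {y} → ∃[ ℓ ] (ℓ < N × t ℓ ≡ 1 × y ≡ element ℓ (r ℓ)) → All (R y) (topAt N)
      R-topAt (ℓ , ℓ<N , tℓ≡1 , refl) with t N ≟ 1
      ... | yes tN≡1 = rel ℓ<N ≤-refl tℓ≡1 tN≡1 ∷ []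
      ... | no _     = []

  ChainFamily : (ℕ → ℕ) → List ℕ → Set
  ChainFamily f μ = Σ[ bs ∈ List (List C) ]
    (All (IsChain _≼_) bs × All (λ b → 1 ≤ length b) bs × Unique (concat bs)
     × map length bs ≡ μ × All (Available f) (concat bs))

  module TopChain {f : ℕ → ℕ} (f≤width : ∀ ℓ → f ℓ ≤ width ℓ) {x} (D : Decrement height peak f x) where
    open Decrement D public

    f′ : ℕ → ℕ
    f′ ℓ = f ℓ ∸ t ℓ

    open Tops t f′

    B : List C
    B = tops height

    f′≤width : ∀ ℓ → f′ ℓ ≤ width ℓ
    f′≤width ℓ = ≤-trans (m∸n≤m (f ℓ) (t ℓ)) (f≤width ℓ)

    f′<f : ∀ {ℓ} → t ℓ ≡ 1 → f′ ℓ < f ℓ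
    f′<f {ℓ} tℓ≡1 = ≤-reflexive (begin
      suc (f′ ℓ)   ≡⟨ +-comm 1 (f′ ℓ) ⟩
      f′ ℓ + 1     ≡⟨ cong (f′ ℓ +_) (sym tℓ≡1) ⟩
      f′ ℓ + t ℓ   ≡⟨ m∸n+n≡m (t≤f ℓ) ⟩
      f ℓ          ∎)
      where open ≡-Reasoning

    f′<width : ∀ {ℓ} → t ℓ ≡ 1 → f′ ℓ < width ℓ
    f′<width {ℓ} tℓ≡1 = <-≤-trans (f′<f tℓ≡1) (f≤width ℓ)

    length-B : length B ≡ x
    length-B = trans (length-tops t≤1 height) ∑t≡x

    B-chain : IsChain _≼_ B
    B-chain = AllPairs-tops _ height λ ℓ₁<ℓ₂ ℓ₂<h t₁≡1 t₂≡1 →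
      inj₁ (tops-≼ mountain ℓ₁<ℓ₂ ℓ₂<h (f′<width t₁≡1) (f′<width t₂≡1))

    B-unique : Unique B
    B-unique = AllPairs-tops _≢_ height λ {ℓ₁} {ℓ₂} ℓ₁<ℓ₂ _ t₁≡1 t₂≡1 eq → <⇒≢ ℓ₁<ℓ₂ (begin
      ℓ₁                          ≡⟨ sym (level-element (f′<width t₁≡1)) ⟩
      level (element ℓ₁ (f′ ℓ₁))  ≡⟨ cong level eq ⟩
      level (element ℓ₂ (f′ ℓ₂))  ≡⟨ level-element (f′<width t₂≡1) ⟩
      ℓ₂                          ∎)
      where open ≡-Reasoning

    private
      top-level-rank : ∀ {y} → y ∈ B → rank y ≡ f′ (level y) × t (level y) ≡ 1
      top-level-rank y∈B with ∈-tops⁻ height y∈B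
      ... | ℓ , _ , tℓ≡1 , refl rewrite level-element (f′<width tℓ≡1) =
        rank-element (f′<width tℓ≡1) , tℓ≡1

    B-available : All (Available f) B
    B-available = All.tabulate λ y∈B →
      let rank≡ , t≡1 = top-level-rank y∈B in subst (_< f _) (sym rank≡) (f′<f t≡1)

    -- the tops have rank exactly f′, every element still available has a smaller rank
    B-disjoint : ∀ {xs} → All (Available f′) xs → Disjoint B xs
    B-disjoint available (y∈B , y∈xs) =
      <-irrefl (proj₁ (top-level-rank y∈B)) (All.lookup available y∈xs)

  extend : ∀ {f x μ} (f≤width : ∀ ℓ → f ℓ ≤ width ℓ) (D : Decrement height peak f x) → 1 ≤ x →
           ChainFamily (TopChain.f′ f≤width D) μ → ChainFamily f (x ∷ μ)
  extend {f} {x} f≤width D 1≤x (bs , chains , nonempty , unique , lengths , available) =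
    B ∷ bs , B-chain ∷ chains , subst (1 ≤_) (sym length-B) 1≤x ∷ nonempty ,
    Unique.++⁺ B-unique unique (B-disjoint available) , cong₂ _∷_ length-B lengths ,
    All.++⁺ B-available (All.map (λ {y} y<f′ → <-≤-trans y<f′ (m∸n≤m (f (level y)) (t (level y)))) available)
    where open TopChain f≤width D

  greedy : ∀ μ {f} → IsPartition μ → (∀ ℓ → f ℓ ≤ width ℓ) → Mountain peak f → Fits height f μ →
           ChainFamily f μ
  greedy []      _                     _       _  _    = [] , [] , [] , [] , refl , []
  greedy (x ∷ μ) {f} (lnk , 1≤x ∷ pos) f≤width mf fits =
    extend f≤width D 1≤x (greedy μ (Linked.tail lnk , pos) f′≤width mountain (Fits-decrement lnk fits D))
    where
    D : Decrement height peak f x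
    D = decrement peak<height mf 1≤x (subst (_≤ _) (+-identityʳ x) (fits 1))
    open TopChain f≤width D using (f′≤width; mountain)

  private
    onLevel : ∀ ℓ (y : C) → Dec (ℓ ≡ level y)
    onLevel ℓ y = ℓ ≟ level y

    count : ℕ → List C → ℕ
    count ℓ xs = length (filter (onLevel ℓ) xs)

  length≡∑count : ∀ xs → length xs ≡ ∑ height (λ ℓ → count ℓ xs)
  length≡∑count []       = sym (∑-zero height λ _ _ → refl)
  length≡∑count (y ∷ ys) = begin
    suc (length ys)                                               ≡⟨ cong suc (length≡∑count ys) ⟩
    suc (∑ height (λ ℓ → count ℓ ys))
      ≡⟨ cong (_+ ∑ height (λ ℓ → count ℓ ys)) (sym (𝟙-yes (level<height y) (level y <? height))) ⟩
    𝟙 (level y <? height) + ∑ height (λ ℓ → count ℓ ys)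
      ≡⟨ cong (_+ ∑ height (λ ℓ → count ℓ ys)) (sym (∑-𝟙-≡ height (level y))) ⟩
    ∑ height (λ ℓ → 𝟙 (onLevel ℓ y)) + ∑ height (λ ℓ → count ℓ ys) ≡⟨ sym (∑-distrib-+ height _ _) ⟩
    ∑ height (λ ℓ → 𝟙 (onLevel ℓ y) + count ℓ ys)
      ≡⟨ ∑-cong height (λ ℓ _ → sym (length-filter-∷ (onLevel ℓ) y ys)) ⟩
    ∑ height (λ ℓ → count ℓ (y ∷ ys))                             ∎
    where open ≡-Reasoning

  count≤width : ∀ ℓ xs → Unique xs → count ℓ xs ≤ width ℓ
  count≤width ℓ xs unique = subst (_≤ width ℓ) (length-map rank zs)
    (Unique-<⇒length≤ (width ℓ) (map rank zs) (ranks-distinct on-ℓ (Unique.filter⁺ (onLevel ℓ) unique)) ranks<width)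
    where
    zs : List C
    zs = filter (onLevel ℓ) xs

    on-ℓ : All (λ z → ℓ ≡ level z) zs
    on-ℓ = All.all-filter (onLevel ℓ) xs

    ranks-distinct : ∀ {zs} → All (λ z → ℓ ≡ level z) zs → Unique zs → Unique (map rank zs)
    ranks-distinct []       []           = []
    ranks-distinct (e ∷ es) (z∉zs ∷ uzs) =
      All.map⁺ (All.zipWith (λ (e′ , z≢w) rank≡ → z≢w (level-rank-injective (trans (sym e) e′) rank≡)) (es , z∉zs))
      ∷ ranks-distinct es uzs

    ranks<width : All (_< width ℓ) (map rank zs)
    ranks<width = All.map⁺ (All.map (λ {z} e → subst (λ l → rank z < width l) (sym e) (rank<width z)) on-ℓ)

  chain-count≤1 : ∀ ℓ xs → IsChain _≼_ xs → Unique xs → count ℓ xs ≤ 1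
  chain-count≤1 ℓ xs chain unique =
    atMostOne (filter (onLevel ℓ) xs) (AllPairs.filter⁺ (onLevel ℓ) chain) (Unique.filter⁺ (onLevel ℓ) unique)
      (All.all-filter (onLevel ℓ) xs)
    where
    atMostOne : ∀ zs → IsChain _≼_ zs → Unique zs → All (λ z → ℓ ≡ level z) zs → length zs ≤ 1
    atMostOne []           _                      _                  _              = z≤n
    atMostOne (_ ∷ [])     _                      _                  _              = ≤-refl
    atMostOne (z ∷ w ∷ _) ((inj₁ z≼w ∷ _) ∷ _) ((z≢w ∷ _) ∷ _) (ez ∷ ew ∷ _) =
      contradiction (≼-level-injective z≼w (trans (sym ez) ew)) z≢w
    atMostOne (z ∷ w ∷ _) ((inj₂ w≼z ∷ _) ∷ _) ((z≢w ∷ _) ∷ _) (ez ∷ ew ∷ _) =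
      contradiction (sym (≼-level-injective w≼z (trans (sym ew) ez))) z≢w

  count-concat≤ : ∀ ℓ bs → All (IsChain _≼_) bs → Unique (concat bs) → count ℓ (concat bs) ≤ length bs
  count-concat≤ ℓ []       _              _      = z≤n
  count-concat≤ ℓ (b ∷ bs) (chain ∷ chains) unique = begin
    count ℓ (b ++ concat bs)                   ≡⟨ cong length (filter-++ (onLevel ℓ) b (concat bs)) ⟩
    length (filter _ b ++ filter _ (concat bs)) ≡⟨ length-++ (filter (onLevel ℓ) b) ⟩
    count ℓ b + count ℓ (concat bs)            ≤⟨ +-mono-≤ (chain-count≤1 ℓ b chain (AllPairs-++⁻ˡ b unique))
                                                          (count-concat≤ ℓ bs chains (AllPairs-++⁻ʳ b unique)) ⟩
    suc (length bs)                            ∎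
    where open ≤-Reasoning

  sum-map-length : ∀ (xss : List (List C)) → sum (map length xss) ≡ length (concat xss)
  sum-map-length []         = refl
  sum-map-length (xs ∷ xss) = trans (cong (length xs +_) (sum-map-length xss)) (sym (length-++ xs))

  -- each chain meets each level at most once
  chainFamily-Fits : ∀ bs → All (IsChain _≼_) bs → Unique (concat bs) → Fits height width (map length bs)
  chainFamily-Fits bs chains unique k = begin
    sum (take k (map length bs))           ≡⟨ cong sum (take-map k bs) ⟩
    sum (map length (take k bs))           ≡⟨ sum-map-length (take k bs) ⟩
    length prefix                          ≡⟨ length≡∑count prefix ⟩
    ∑ height (λ ℓ → count ℓ prefix)
      ≤⟨ ∑-mono-≤ height (λ ℓ _ → ⊓-glb (count≤k ℓ) (count≤width ℓ prefix unique-prefix)) ⟩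
    ∑ height (λ ℓ → k ⊓ width ℓ)           ∎
    where
    open ≤-Reasoning

    prefix : List C
    prefix = concat (take k bs)

    unique-prefix : Unique prefix
    unique-prefix = AllPairs-++⁻ˡ prefix (subst Unique
      (trans (cong concat (sym (take++drop≡id k bs))) (sym (concat-++ (take k bs) (drop k bs)))) unique)

    count≤k : ∀ ℓ → count ℓ prefix ≤ k
    count≤k ℓ = ≤-trans (count-concat≤ ℓ (take k bs) (All.take⁺ k chains) unique-prefix)
                        (≤-trans (≤-reflexive (length-take k bs)) (m⊓n≤m k _))

  nice : Nice _≼_
  nice λs μ _ μ-partition ∑μ≡∑λ μ⊴λ (bsλ , (chainsλ , _ , uniqueλ , complete) , lengthsλ) =
    completeFamily (greedy μ μ-partition (λ _ → ≤-refl) width-mountain λ k → ≤-trans (μ⊴λ k) (fitsλ k))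
    where
    fitsλ : Fits height width λs
    fitsλ = subst (Fits height width) lengthsλ (chainFamily-Fits bsλ chainsλ uniqueλ)

    completeFamily : ChainFamily width μ → HasChainPartitionOfType _≼_ μ
    completeFamily (bs , chains , nonempty , unique , lengths , _) =
      bs , (chains , nonempty , unique , Unique-length≥⇒complete _≟C_ (concat bs) (concat bsλ) unique complete size) ,
      lengths
      where
      size : length (concat bsλ) ≤ length (concat bs)
      size = ≤-reflexive (begin
        length (concat bsλ)     ≡⟨ sym (sum-map-length bsλ) ⟩
        sum (map length bsλ)    ≡⟨ cong sum lengthsλ ⟩
        sum λs                  ≡⟨ sym ∑μ≡∑λ ⟩
        sum μ                   ≡⟨ cong sum (sym lengths) ⟩
        sum (map length bs)     ≡⟨ sum-map-length bs ⟩
        length (concat bs)      ∎)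
        where open ≡-Reasoning

-- The grid 𝐦 × 𝐧

<∸⇒+< : ∀ {ρ x y} → ρ < x ∸ y → y + ρ < x
<∸⇒+< {ρ} {x} {y} ρ<x∸y = subst (_≤ x) (cong suc (+-comm ρ y)) (m≤o∸n⇒m+n≤o (suc ρ) (<⇒≤ y<x) ρ<x∸y)
  where
  y<x : y < x
  y<x = m∸n≢0⇒n<m λ x∸y≡0 → n≮0 (subst (ρ <_) x∸y≡0 ρ<x∸y)

clamp : ∀ n → ℕ → Fin (suc n)
clamp n x = fromℕ< (s≤s (m⊓n≤n x n))

toℕ-clamp : ∀ {n x} → x ≤ n → toℕ (clamp n x) ≡ x
toℕ-clamp {n} {x} x≤n = trans (Fin.toℕ-fromℕ< (s≤s (m⊓n≤n x n))) (m≤n⇒m⊓n≡m x≤n)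

-- Cells of 𝐦 × 𝐧 with m = suc a, n = suc b are graded by the antidiagonal t = i + j; the
-- cells of antidiagonal t are numbered ρ = 0, 1, … by increasing row, starting at row t ∸ b.
module Grid (a b : ℕ) where

  Cell : Set
  Cell = Fin (suc a) × Fin (suc b)

  _⊑_ : Cell → Cell → Set
  _⊑_ = ProdOrd (ChainOrd (suc a)) (ChainOrd (suc b))

  width : ℕ → ℕ
  width t = suc (t ⊓ a) ∸ (t ∸ b)

  row : ℕ → ℕ → ℕ
  row t ρ = (t ∸ b) + ρ

  -- clamping only matters for invalid ρ ≥ width t
  cell : ℕ → ℕ → Cell
  cell t ρ = clamp a (row t ρ) , clamp b (t ∸ row t ρ)

  level : Cell → ℕ
  level (i , j) = toℕ i + toℕ j

  rank : Cell → ℕ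
  rank (i , j) = toℕ i ⊓ (b ∸ toℕ j)

  row≤⊓ : ∀ {t ρ} → ρ < width t → row t ρ ≤ t ⊓ a
  row≤⊓ ρ<w = ≤-pred (<∸⇒+< ρ<w)

  <width : ∀ {t ρ} → row t ρ ≤ t ⊓ a → ρ < width t
  <width {t} {ρ} row≤ = m+n≤o⇒m≤o∸n (suc ρ) (s≤s (subst (_≤ t ⊓ a) (+-comm (t ∸ b) ρ) row≤))

  column≤b : ∀ t ρ → t ∸ row t ρ ≤ b
  column≤b t ρ = ≤-trans (∸-monoʳ-≤ t (m≤m+n (t ∸ b) ρ))
    (m≤n+o⇒m∸n≤o t (t ∸ b) (subst (t ≤_) (+-comm b (t ∸ b)) (m≤n+m∸n t b)))

  toℕ-cell : ∀ {t ρ} → ρ < width t → toℕ (proj₁ (cell t ρ)) ≡ row t ρ × toℕ (proj₂ (cell t ρ)) ≡ t ∸ row t ρ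
  toℕ-cell {t} {ρ} ρ<w = toℕ-clamp (≤-trans (row≤⊓ ρ<w) (m⊓n≤n t a)) , toℕ-clamp (column≤b t ρ)

  level-cell : ∀ {t ρ} → ρ < width t → level (cell t ρ) ≡ t
  level-cell {t} {ρ} ρ<w = trans (cong₂ _+_ (proj₁ (toℕ-cell ρ<w)) (proj₂ (toℕ-cell ρ<w)))
                                 (m+[n∸m]≡n (≤-trans (row≤⊓ ρ<w) (m⊓n≤m t a)))

  rank-cell : ∀ {t ρ} → ρ < width t → rank (cell t ρ) ≡ ρ
  rank-cell {t} {ρ} ρ<w rewrite proj₁ (toℕ-cell ρ<w) | proj₂ (toℕ-cell ρ<w) with t ≤? b
  ... | yes t≤b rewrite m≤n⇒m∸n≡0 t≤b =
    m≤n⇒m⊓n≡m (m+n≤o⇒m≤o∸n ρ (≤-trans (≤-reflexive (m+[n∸m]≡n ρ≤t)) t≤b))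
    where
    ρ≤t : ρ ≤ t
    ρ≤t = ≤-trans (≤-pred ρ<w) (m⊓n≤m t a)
  ... | no t≰b = begin
    row t ρ ⊓ (b ∸ (t ∸ row t ρ)) ≡⟨ cong (λ z → row t ρ ⊓ (b ∸ z)) t∸row≡b∸ρ ⟩
    row t ρ ⊓ (b ∸ (b ∸ ρ))       ≡⟨ cong (row t ρ ⊓_) (m∸[m∸n]≡n ρ≤b) ⟩
    row t ρ ⊓ ρ                   ≡⟨ m≥n⇒m⊓n≡n (m≤n+m ρ (t ∸ b)) ⟩
    ρ                             ∎
    where
    open ≡-Reasoning
    t≡t∸b+b : t ≡ (t ∸ b) + b
    t≡t∸b+b = sym (m∸n+n≡m (<⇒≤ (≰⇒> t≰b)))
    t∸row≡b∸ρ : t ∸ row t ρ ≡ b ∸ ρ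
    t∸row≡b∸ρ = trans (cong (_∸ row t ρ) t≡t∸b+b) ([m+n]∸[m+o]≡n∸o (t ∸ b) b ρ)
    ρ≤b : ρ ≤ b
    ρ≤b = +-cancelˡ-≤ (t ∸ b) ρ b (subst (row t ρ ≤_) t≡t∸b+b (≤-trans (row≤⊓ ρ<w) (m⊓n≤m t a)))

  row-rank : ∀ i j → j ≤ b → row (i + j) (i ⊓ (b ∸ j)) ≡ i
  row-rank i j j≤b with i ≤? b ∸ j
  ... | yes i≤b∸j rewrite m≤n⇒m⊓n≡m i≤b∸j
                        | m≤n⇒m∸n≡0 (subst (i + j ≤_) (m∸n+n≡m j≤b) (+-monoˡ-≤ j i≤b∸j)) = refl
  ... | no  i≰b∸j rewrite m≥n⇒m⊓n≡n (<⇒≤ (≰⇒> i≰b∸j)) = begin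
    (i + j ∸ b) + (b ∸ j)      ≡⟨ cong (_+ (b ∸ j)) i+j∸b≡i∸[b∸j] ⟩
    (i ∸ (b ∸ j)) + (b ∸ j)    ≡⟨ m∸n+n≡m (<⇒≤ (≰⇒> i≰b∸j)) ⟩
    i                          ∎
    where
    open ≡-Reasoning
    i+j∸b≡i∸[b∸j] : i + j ∸ b ≡ i ∸ (b ∸ j)
    i+j∸b≡i∸[b∸j] = trans (cong₂ _∸_ (+-comm i j) (trans (sym (m∸n+n≡m j≤b)) (+-comm (b ∸ j) j)))
                          ([m+n]∸[m+o]≡n∸o j i (b ∸ j))

  rank<width : ∀ c → rank c < width (level c)
  rank<width (i , j) = <width (subst (_≤ level (i , j) ⊓ a) (sym (row-rank (toℕ i) (toℕ j) j≤b))
                                     (⊓-glb (m≤m+n (toℕ i) (toℕ j)) (≤-pred (Fin.toℕ<n i))))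
    where
    j≤b : toℕ j ≤ b
    j≤b = ≤-pred (Fin.toℕ<n j)

  cell-level-rank : ∀ c → cell (level c) (rank c) ≡ c
  cell-level-rank (i , j) = cong₂ _,_
    (Fin.toℕ-injective (trans (proj₁ (toℕ-cell ρ<w)) row≡i))
    (Fin.toℕ-injective (trans (proj₂ (toℕ-cell ρ<w)) (trans (cong (toℕ i + toℕ j ∸_) row≡i) (m+n∸m≡n (toℕ i) (toℕ j)))))
    where
    ρ<w : rank (i , j) < width (level (i , j))
    ρ<w = rank<width (i , j)

    row≡i : row (toℕ i + toℕ j) (rank (i , j)) ≡ toℕ i
    row≡i = row-rank (toℕ i) (toℕ j) (≤-pred (Fin.toℕ<n j))

  level<1+a+b : ∀ c → level c < suc (a + b)
  level<1+a+b (i , j) = s≤s (+-mono-≤ (≤-pred (Fin.toℕ<n i)) (≤-pred (Fin.toℕ<n j)))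

  width-rise : ∀ t → t < b → UnitRise (width t) (width (suc t))
  width-rise t t<b rewrite m≤n⇒m∸n≡0 (<⇒≤ t<b) | m≤n⇒m∸n≡0 t<b =
    s≤s (proj₁ (UnitRise-⊓ t a)) , s≤s (proj₂ (UnitRise-⊓ t a))

  width-fall : ∀ t → b ≤ t → UnitRise (width (suc t)) (width t)
  width-fall t b≤t rewrite +-∸-assoc 1 b≤t = UnitRise-∸ (t ∸ b) (UnitRise-⊓ t a)

  width-0 : width 0 ≡ 1
  width-0 rewrite 0∸n≡0 b = refl

  width-last : width (a + b) ≡ 1
  width-last rewrite m+n∸n≡m a b | m≥n⇒m⊓n≡n (m≤m+n a b) = m+n∸n≡m 1 a

  row-rise : ∀ {g} → Mountain b g → ∀ t → UnitRise (row t (g t)) (row (suc t) (g (suc t)))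
  row-rise {g} (up , down) t with t <? b
  ... | yes t<b rewrite m≤n⇒m∸n≡0 (<⇒≤ t<b) | m≤n⇒m∸n≡0 t<b = up t t<b
  ... | no  t≮b rewrite +-∸-assoc 1 (≮⇒≥ t≮b) =
    let g′≤g , g≤1+g′ = down t (≮⇒≥ t≮b)
    in ≤-trans (+-monoʳ-≤ (t ∸ b) g≤1+g′) (≤-reflexive (+-suc (t ∸ b) _)) , s≤s (+-monoʳ-≤ (t ∸ b) g′≤g)

  -- the row (t ∸ b) + g t grows by 0 or 1 with t, so the column t ∸ row weakly increases too
  cell-mono : ∀ {g} → Mountain b g → ∀ {t t′} → t ≤ t′ → g t < width t → g t′ < width t′ →
              cell t (g t) ⊑ cell t′ (g t′)
  cell-mono {g} mg {t} {t′} t≤t′ v v′ =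
    subst₂ _≤_ (sym (proj₁ (toℕ-cell v))) (sym (proj₁ (toℕ-cell v′))) (proj₁ mono) ,
    subst₂ _≤_ (sym (proj₂ (toℕ-cell v))) (sym (proj₂ (toℕ-cell v′))) (proj₂ mono)
    where
    mono : row t (g t) ≤ row t′ (g t′) × t ∸ row t (g t) ≤ t′ ∸ row t′ (g t′)
    mono = UnitRise-mono (λ s → row s (g s)) (row-rise mg) t≤t′

  ⊑-level-injective : ∀ {c c′} → c ⊑ c′ → level c ≡ level c′ → c ≡ c′
  ⊑-level-injective {i , j} {i′ , j′} (i≤i′ , j≤j′) i+j≡i′+j′ =
    cong₂ _,_ (Fin.toℕ-injective i≡i′)
      (Fin.toℕ-injective (+-cancelˡ-≡ (toℕ i) _ _ (trans i+j≡i′+j′ (cong (_+ toℕ j′) (sym i≡i′)))))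
    where
    i≡i′ : toℕ i ≡ toℕ i′
    i≡i′ = ≤-antisym i≤i′ (+-cancelʳ-≤ (toℕ j) (toℕ i′) (toℕ i)
             (≤-trans (+-monoʳ-≤ (toℕ i′) j≤j′) (≤-reflexive (sym i+j≡i′+j′))))

-- The levels of 𝐩 ⊕ (𝐦 × 𝐧) ⊕ 𝐪

data Split (n : ℕ) : ℕ → Set where
  lo : ∀ {i} → i < n → Split n i
  hi : ∀ k → Split n (n + k)

split : ∀ n ℓ → Split n ℓ
split zero    ℓ       = hi ℓ
split (suc n) zero    = lo z<s
split (suc n) (suc ℓ) with split n ℓ
... | lo i<n = lo (s<s i<n)
... | hi k   = hi k

split-lo : ∀ {n i} (i<n : i < n) → split n i ≡ lo i<n
split-lo {suc n} {zero}  z<s        = refl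
split-lo {suc n} {suc i} (s<s i<n) rewrite split-lo i<n = refl

split-hi : ∀ n k → split n (n + k) ≡ hi k
split-hi zero    k = refl
split-hi (suc n) k rewrite split-hi n k = refl

module Concrete (p a b q : ℕ) where

  module G = Grid a b

  C : Set
  C = Carrier p (suc a) (suc b) q

  _≼_ : C → C → Set
  _≼_ = Ord p (suc a) (suc b) q

  H : ℕ
  H = suc (a + b)

  height : ℕ
  height = p + (H + q)

  data Part : Set where
    below  : Fin p → Part
    grid   : ℕ → Part
    above  : Fin q → Part
    beyond : Part

  part : ℕ → Part
  part ℓ with split p ℓ
  ... | lo i<p = below (fromℕ< i<p)
  ... | hi r with split H r
  ...   | lo {t} _ = grid t
  ...   | hi k with split q k
  ...     | lo k<q = above (fromℕ< k<q)
  ...     | hi _   = beyond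

  widthOf : Part → ℕ
  widthOf (below _) = 1
  widthOf (grid t)  = G.width t
  widthOf (above _) = 1
  widthOf beyond    = 0

  elementOf : Part → ℕ → C
  elementOf (below i) _ = inj₁ i
  elementOf (grid t)  ρ = inj₂ (inj₁ (G.cell t ρ))
  elementOf (above k) _ = inj₂ (inj₂ k)
  elementOf beyond    _ = inj₂ (inj₁ (G.cell 0 0))

  width : ℕ → ℕ
  width ℓ = widthOf (part ℓ)

  element : ℕ → ℕ → C
  element ℓ = elementOf (part ℓ)

  level : C → ℕ
  level (inj₁ i)        = toℕ i
  level (inj₂ (inj₁ c)) = p + G.level c
  level (inj₂ (inj₂ k)) = p + (H + toℕ k)

  rank : C → ℕ
  rank (inj₁ _)        = 0
  rank (inj₂ (inj₁ c)) = G.rank c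
  rank (inj₂ (inj₂ _)) = 0

  data Position : ℕ → Set where
    below  : ∀ {i} → i < p → Position i
    grid   : ∀ {t} → t < H → Position (p + t)
    above  : ∀ {k} → k < q → Position (p + (H + k))
    beyond : ∀ {ℓ} → height ≤ ℓ → Position ℓ

  position : ∀ ℓ → Position ℓ
  position ℓ with split p ℓ
  ... | lo i<p = below i<p
  ... | hi r with split H r
  ...   | lo t<H = grid t<H
  ...   | hi k with split q k
  ...     | lo k<q = above k<q
  ...     | hi r′  = beyond (+-monoʳ-≤ p (+-monoʳ-≤ H (m≤m+n q r′)))

  level-element : ∀ {ℓ ρ} → ρ < width ℓ → level (element ℓ ρ) ≡ ℓ
  level-element {ℓ} ρ<w with split p ℓ
  ... | lo i<p = Fin.toℕ-fromℕ< i<p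
  ... | hi r with split H r
  ...   | lo _ = cong (p +_) (G.level-cell ρ<w)
  ...   | hi k with split q k
  ...     | lo k<q = cong (λ z → p + (H + z)) (Fin.toℕ-fromℕ< k<q)
  ...     | hi _   = contradiction ρ<w λ ()

  rank-element : ∀ {ℓ ρ} → ρ < width ℓ → rank (element ℓ ρ) ≡ ρ
  rank-element {ℓ} ρ<w with split p ℓ
  ... | lo _ = sym (n<1⇒n≡0 ρ<w)
  ... | hi r with split H r
  ...   | lo _ = G.rank-cell ρ<w
  ...   | hi k with split q k
  ...     | lo _ = sym (n<1⇒n≡0 ρ<w)
  ...     | hi _ = contradiction ρ<w λ ()

  part-below : ∀ {i} (i<p : i < p) → part i ≡ below (fromℕ< i<p)
  part-below i<p rewrite split-lo i<p = refl

  part-grid : ∀ {t} → t < H → part (p + t) ≡ grid t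
  part-grid {t} t<H rewrite split-hi p t | split-lo t<H = refl

  part-above : ∀ {k} (k<q : k < q) → part (p + (H + k)) ≡ above (fromℕ< k<q)
  part-above {k} k<q rewrite split-hi p (H + k) | split-hi H k | split-lo k<q = refl

  element-level-rank : ∀ x → element (level x) (rank x) ≡ x
  element-level-rank (inj₁ i) rewrite part-below (Fin.toℕ<n i) = cong inj₁ (Fin.fromℕ<-toℕ i _)
  element-level-rank (inj₂ (inj₁ c)) rewrite part-grid (G.level<1+a+b c) = cong (inj₂ ∘ inj₁) (G.cell-level-rank c)
  element-level-rank (inj₂ (inj₂ k)) rewrite part-above (Fin.toℕ<n k) = cong (inj₂ ∘ inj₂) (Fin.fromℕ<-toℕ k _)

  level<height : ∀ x → level x < height
  level<height (inj₁ i)        = ≤-trans (Fin.toℕ<n i) (m≤m+n p _)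
  level<height (inj₂ (inj₁ c)) = +-monoʳ-< p (≤-trans (G.level<1+a+b c) (m≤m+n H q))
  level<height (inj₂ (inj₂ k)) = +-monoʳ-< p (+-monoʳ-< H (Fin.toℕ<n k))

  rank<width : ∀ x → rank x < width (level x)
  rank<width (inj₁ i)        rewrite part-below (Fin.toℕ<n i) = z<s
  rank<width (inj₂ (inj₁ c)) rewrite part-grid (G.level<1+a+b c) = G.rank<width c
  rank<width (inj₂ (inj₂ k)) rewrite part-above (Fin.toℕ<n k) = z<s

  ≼-level-injective : ∀ {x y} → x ≼ y → level x ≡ level y → x ≡ y
  ≼-level-injective {inj₁ i} {inj₁ j} _ e = cong inj₁ (Fin.toℕ-injective e)
  ≼-level-injective {inj₁ i} {inj₂ (inj₁ _)} _ e = contradiction e (<⇒≢ (≤-trans (Fin.toℕ<n i) (m≤m+n p _)))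
  ≼-level-injective {inj₁ i} {inj₂ (inj₂ _)} _ e = contradiction e (<⇒≢ (≤-trans (Fin.toℕ<n i) (m≤m+n p _)))
  ≼-level-injective {inj₂ (inj₁ c)} {inj₂ (inj₁ c′)} c⊑c′ e =
    cong (inj₂ ∘ inj₁) (G.⊑-level-injective c⊑c′ (+-cancelˡ-≡ p _ _ e))
  ≼-level-injective {inj₂ (inj₁ c)} {inj₂ (inj₂ k)} _ e =
    contradiction (+-cancelˡ-≡ p _ _ e) (<⇒≢ (≤-trans (G.level<1+a+b c) (m≤m+n H _)))
  ≼-level-injective {inj₂ (inj₂ k)} {inj₂ (inj₂ k′)} _ e =
    cong (inj₂ ∘ inj₂) (Fin.toℕ-injective (+-cancelˡ-≡ H _ _ (+-cancelˡ-≡ p _ _ e)))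

  peak : ℕ
  peak = p + b

  peak<height : peak < height
  peak<height = +-monoʳ-< p (≤-trans (s≤s (m≤n+m b a)) (m≤m+n H q))

  width-grid : ∀ {t} → t < H → width (p + t) ≡ G.width t
  width-grid t<H = cong widthOf (part-grid t<H)

  width-beyond : ∀ {ℓ} → height ≤ ℓ → width ℓ ≡ 0
  width-beyond {ℓ} h≤ℓ with split p ℓ
  ... | lo i<p = contradiction (≤-trans (m≤m+n p _) h≤ℓ) (<⇒≱ i<p)
  ... | hi r with split H r
  ...   | lo t<H = contradiction h≤ℓ (<⇒≱ (+-monoʳ-< p (≤-trans t<H (m≤m+n H q))))
  ...   | hi k with split q k
  ...     | lo k<q = contradiction h≤ℓ (<⇒≱ (+-monoʳ-< p (+-monoʳ-< H k<q)))
  ...     | hi _   = refl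

  width-after-grid≤1 : ∀ {ℓ} → p + H ≤ ℓ → width ℓ ≤ 1
  width-after-grid≤1 {ℓ} p+H≤ℓ with position ℓ
  ... | below i<p   = contradiction (≤-trans (m≤m+n p H) p+H≤ℓ) (<⇒≱ i<p)
  ... | grid t<H    = contradiction p+H≤ℓ (<⇒≱ (+-monoʳ-< p t<H))
  ... | above k<q   rewrite part-above k<q = ≤-refl
  ... | beyond h≤ℓ  rewrite width-beyond h≤ℓ = z≤n

  width-below-rise : ∀ {i} → i < p → UnitRise (width i) (width (suc i))
  width-below-rise {i} i<p rewrite part-below i<p with m≤n⇒m<n∨m≡n i<p
  ... | inj₁ 1+i<p rewrite part-below 1+i<p = ≤-refl , n≤1+n 1
  ... | inj₂ 1+i≡p rewrite cong width (trans 1+i≡p (sym (+-identityʳ p))) | width-grid {0} z<s | G.width-0 =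
    ≤-refl , n≤1+n 1

  width-grid-rise : ∀ {t} → t < b → UnitRise (width (p + t)) (width (suc (p + t)))
  width-grid-rise {t} t<b rewrite sym (+-suc p t) | width-grid {t} (m<n⇒m<1+n (<-≤-trans t<b (m≤n+m b a)))
                                  | width-grid {suc t} (s≤s (<-≤-trans t<b (m≤n+m b a))) = G.width-rise t t<b

  width-grid-fall : ∀ {t} → b ≤ t → t < H → UnitRise (width (suc (p + t))) (width (p + t))
  width-grid-fall {t} b≤t t<H rewrite width-grid t<H with suc t <? H
  ... | yes 1+t<H rewrite sym (+-suc p t) | width-grid 1+t<H = G.width-fall t b≤t
  ... | no  1+t≮H rewrite ≤-antisym (≤-pred t<H) (≤-pred (≮⇒≥ 1+t≮H)) | G.width-last =
    width-after-grid≤1 (subst (p + H ≤_) (+-suc p (a + b)) ≤-refl) , s≤s z≤n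

  width-above-fall : ∀ {k} → k < q → UnitRise (width (suc (p + (H + k)))) (width (p + (H + k)))
  width-above-fall {k} k<q rewrite part-above k<q =
    width-after-grid≤1 (m≤n⇒m≤1+n (+-monoʳ-≤ p (m≤m+n H k))) , s≤s z≤n

  width-mountain : Mountain peak width
  width-mountain = rise , fall
    where
    rise : ∀ ℓ → ℓ < peak → UnitRise (width ℓ) (width (suc ℓ))
    rise ℓ ℓ<peak with position ℓ
    ... | below i<p   = width-below-rise i<p
    ... | grid _      = width-grid-rise (+-cancelˡ-< p _ b ℓ<peak)
    ... | above {k} _ = contradiction ℓ<peak (≤⇒≯ (+-monoʳ-≤ p (≤-trans (m≤n+m b (suc a)) (m≤m+n H k))))
    ... | beyond h≤ℓ  = contradiction ℓ<peak (≤⇒≯ (≤-trans (<⇒≤ peak<height) h≤ℓ))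

    fall : ∀ ℓ → peak ≤ ℓ → UnitRise (width (suc ℓ)) (width ℓ)
    fall ℓ peak≤ℓ with position ℓ
    ... | below i<p  = contradiction (≤-trans (m≤m+n p b) peak≤ℓ) (<⇒≱ i<p)
    ... | grid t<H   = width-grid-fall (+-cancelˡ-≤ p b _ peak≤ℓ) t<H
    ... | above k<q  = width-above-fall k<q
    ... | beyond h≤ℓ rewrite width-beyond h≤ℓ | width-beyond (m≤n⇒m≤1+n h≤ℓ) = z≤n , z≤n

  element-below : ∀ {i} (i<p : i < p) ρ → element i ρ ≡ inj₁ (fromℕ< i<p)
  element-below i<p ρ = cong (λ P → elementOf P ρ) (part-below i<p)

  element-grid : ∀ {t} → t < H → ∀ ρ → element (p + t) ρ ≡ inj₂ (inj₁ (G.cell t ρ))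
  element-grid t<H ρ = cong (λ P → elementOf P ρ) (part-grid t<H)

  element-above : ∀ {k} (k<q : k < q) ρ → element (p + (H + k)) ρ ≡ inj₂ (inj₂ (fromℕ< k<q))
  element-above k<q ρ = cong (λ P → elementOf P ρ) (part-above k<q)

  tops-≼ : ∀ {f} → Mountain peak f → ∀ {ℓ₁ ℓ₂} → ℓ₁ < ℓ₂ → ℓ₂ < height →
           f ℓ₁ < width ℓ₁ → f ℓ₂ < width ℓ₂ → element ℓ₁ (f ℓ₁) ≼ element ℓ₂ (f ℓ₂)
  tops-≼ {f} mf {ℓ₁} {ℓ₂} ℓ₁<ℓ₂ ℓ₂<h v₁ v₂ with position ℓ₁ | position ℓ₂
  ... | _ | beyond h≤ℓ₂ = contradiction ℓ₂<h (≤⇒≯ h≤ℓ₂)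
  ... | beyond h≤ℓ₁ | _ = contradiction (<-trans ℓ₁<ℓ₂ ℓ₂<h) (≤⇒≯ h≤ℓ₁)
  ... | below i<p | below j<p rewrite element-below i<p (f ℓ₁) | element-below j<p (f ℓ₂) =
    subst₂ _≤_ (sym (Fin.toℕ-fromℕ< i<p)) (sym (Fin.toℕ-fromℕ< j<p)) (<⇒≤ ℓ₁<ℓ₂)
  ... | below i<p | grid t<H  rewrite element-below i<p (f ℓ₁) | element-grid t<H (f ℓ₂) = tt
  ... | below i<p | above k<q rewrite element-below i<p (f ℓ₁) | element-above k<q (f ℓ₂) = tt
  ... | grid {t} _ | below j<p = contradiction (<-trans ℓ₁<ℓ₂ j<p) (≤⇒≯ (m≤m+n p t))
  ... | grid {t} t<H | grid {t′} t′<H rewrite element-grid t<H (f (p + t)) | element-grid t′<H (f (p + t′)) =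
    G.cell-mono (Mountain-shift mf) (<⇒≤ (+-cancelˡ-< p t t′ ℓ₁<ℓ₂))
      (subst (f (p + t) <_) (width-grid t<H) v₁) (subst (f (p + t′) <_) (width-grid t′<H) v₂)
  ... | grid t<H | above k<q rewrite element-grid t<H (f ℓ₁) | element-above k<q (f ℓ₂) = tt
  ... | above {k} _ | below j<p = contradiction (<-trans ℓ₁<ℓ₂ j<p) (≤⇒≯ (m≤m+n p (H + k)))
  ... | above {k} _ | grid t<H =
    contradiction ℓ₁<ℓ₂ (≤⇒≯ (+-monoʳ-≤ p (≤-trans (<⇒≤ t<H) (m≤m+n H k))))
  ... | above k<q | above k′<q rewrite element-above k<q (f ℓ₁) | element-above k′<q (f ℓ₂) =
    subst₂ _≤_ (sym (Fin.toℕ-fromℕ< k<q)) (sym (Fin.toℕ-fromℕ< k′<q))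
      (<⇒≤ (+-cancelˡ-< H _ _ (+-cancelˡ-< p _ _ ℓ₁<ℓ₂)))

  leveling : Leveling _≼_
  leveling = record
    { height = height ; peak = peak
    ; peak<height = peak<height
    ; width = width ; width-mountain = width-mountain
    ; level = level ; rank = rank ; element = element
    ; level<height = level<height ; rank<width = rank<width
    ; element-level-rank = element-level-rank
    ; level-element = level-element ; rank-element = rank-element
    ; ≼-level-injective = ≼-level-injective
    ; tops-≼ = tops-≼
    }

theorem4p5 : (p q m n : ℕ) → 1 ≤ m → 1 ≤ n →
    IsDistributiveLatticePoset (Ord p m n q) × Nice (Ord p m n q)
theorem4p5 p q zero    _       () _
theorem4p5 p q (suc a) zero    _  ()
theorem4p5 p q (suc a) (suc b) _  _  =
  Ord-isDistributiveLatticePoset p (suc a) (suc b) q , LevelingProperties.nice (Concrete.leveling p a b q)
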